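{- Let $d\ge2$ and let $\ell=\lceil d/2\rceil$. Among the values $E_{\ell}(i)$, $0\le i\le d$, the smallest is $E_{\ell}(2)$; that is, the smallest eigenvalue of the graph $J(2d+1,d,\lceil d/2\rceil)$ is $E_{\lceil d/2\rceil}(2)$.
   Context: For $n\ge 2d$ and $0\le j\le d$, $J(n,d,j)$ is the graph whose vertices are the $d$-subsets of an $n$-set, two being adjacent iff they intersect in exactly $d-j$ elements. Its eigenvalues are the Eberlein values $E_j(i)=\sum_{h=0}^{j}(-1)^h\binom{i}{h}\binom{d-i}{j-h}\binom{n-d-i}{j-h}$, $0\le i\le d$; here $n=2d+1$. -}

module Defs where

open import Data.Nat using (ℕ; zero; suc; _+_; _∸_)
open import Data.Nat.Combinatorics using (_C_)
open import Data.Nat.DivMod using (_/_)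
open import Data.Integer as ℤ using (ℤ; +_; -_)

⌈_/2⌉ : ℕ → ℕ
⌈ d /2⌉ = (d + 1) / 2

sign : ℕ → ℤ
sign zero = + 1
sign (suc h) = - sign h

eberleinTerm : (n d j i h : ℕ) → ℤ
eberleinTerm n d j i h =
  sign h ℤ.* (+ ((i C h) Data.Nat.* (((d ∸ i) C (j ∸ h)) Data.Nat.* ((n ∸ d ∸ i) C (j ∸ h)))))

sumTo : ℕ → (ℕ → ℤ) → ℤ
sumTo zero f = f 0
sumTo (suc k) f = sumTo k f ℤ.+ f (suc k)

E : (n d j i : ℕ) → ℤ
E n d j i = sumTo j (eberleinTerm n d j i)

module Submission where

-- For n = 2d + 1 the Eberlein values e(i) = E_j(i) satisfy a three-term recurrence in i,
-- found by creative telescoping of the defining sum over h.  For j = ⌈d/2⌉ it factors: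
-- consecutive values satisfy first-order relations p(i) e(i+1) = q(i) e(i) with explicit
-- polynomial coefficients, p(i) > 0.  These give e(0) ≥ 0 ≥ e(2) and all the ratios
-- |e(i+1)| / |e(i)|.  Along the even indices the two-step ratio increases, so there |e(i)|
-- is bounded by its values at the ends, |e(2)| and (within one step) |e(d)|, while each odd
-- index is dominated by an even neighbour.  The endpoint values e(0) = C(d,j) C(d+1,j) and
-- |e(d)| = C(d,j) together with a central binomial estimate give |e(d)| ≤ |e(2)|.
-- Hence e(2) = -|e(2)| ≤ -|e(i)| ≤ e(i).

module Binomials where

  open import Data.Nat
  open import Data.Nat.Properties
  open import Data.Nat.Combinatorics using (_C_; nCk+nC[k+1]≡[n+1]C[k+1]; k>n⇒nCk≡0)
  open import Data.Nat.Tactic.RingSolver using (solve-∀)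
  open import Relation.Binary.PropositionalEquality
  open import Data.Product using (Σ; _,_)
  open import Data.Sum using (_⊎_; inj₁; inj₂)

  double : ℕ → ℕ
  double zero    = zero
  double (suc n) = suc (suc (double n))

  double-+ : ∀ m n → double (m + n) ≡ double m + double n
  double-+ zero    n = refl
  double-+ (suc m) n = cong (λ x → suc (suc x)) (double-+ m n)

  double≡+ : ∀ n → double n ≡ n + n
  double≡+ zero    = refl
  double≡+ (suc n) = cong suc (trans (cong suc (double≡+ n)) (sym (+-suc n n)))

  n≤double : ∀ n → n ≤ double n
  n≤double zero    = z≤n
  n≤double (suc n) = s≤s (≤-trans (n≤double n) (n≤1+n _))

  double-≤-cancel : ∀ {m n} → double m ≤ suc (double n) → m ≤ n
  double-≤-cancel {zero}          _              = z≤n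
  double-≤-cancel {suc m} {zero}  (s≤s ())
  double-≤-cancel {suc m} {suc n} (s≤s (s≤s le)) = s≤s (double-≤-cancel le)

  even-or-odd : ∀ n → (Σ ℕ λ m → n ≡ double m) ⊎ (Σ ℕ λ m → n ≡ suc (double m))
  even-or-odd zero    = inj₁ (0 , refl)
  even-or-odd (suc n) with even-or-odd n
  ... | inj₁ (m , n≡2m)   = inj₂ (m , cong suc n≡2m)
  ... | inj₂ (m , n≡2m+1) = inj₁ (suc m , cong suc n≡2m+1)

  -- Pascal's rule as the definition, so that identities follow by induction; binom≡C relates it to _C_.
  binom : ℕ → ℕ → ℕ
  binom n       zero    = 1
  binom zero    (suc k) = 0
  binom (suc n) (suc k) = binom n k + binom n (suc k)

  binom≡C : ∀ n k → binom n k ≡ n C k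
  binom≡C n       zero    = refl
  binom≡C zero    (suc k) = sym (k>n⇒nCk≡0 {0} {suc k} (s≤s z≤n))
  binom≡C (suc n) (suc k) =
    trans (cong₂ _+_ (binom≡C n k) (binom≡C n (suc k))) (nCk+nC[k+1]≡[n+1]C[k+1] n k)

  binom-1 : ∀ n → binom n 1 ≡ n
  binom-1 zero    = refl
  binom-1 (suc n) = cong suc (binom-1 n)

  binom-absorb : ∀ n k → suc k * binom (suc n) (suc k) ≡ suc n * binom n k
  binom-absorb n       zero    =
    cong suc (trans (+-identityʳ _) (trans (binom-1 n) (sym (*-identityʳ n))))
  binom-absorb zero    (suc k) = *-zeroʳ (suc (suc k))
  binom-absorb (suc n) (suc k) = begin
    suc (suc k) * (X + Y)
      ≡⟨ split k X Y ⟩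
    X + (suc k * X + suc (suc k) * Y)
      ≡⟨ cong (X +_) (cong₂ _+_ (binom-absorb n k) (binom-absorb n (suc k))) ⟩
    X + (suc n * binom n k + suc n * binom n (suc k))
      ≡⟨ cong (X +_) (sym (*-distribˡ-+ (suc n) (binom n k) _)) ⟩
    suc (suc n) * X ∎
    where
    open ≡-Reasoning
    X = binom (suc n) (suc k)
    Y = binom (suc n) (suc (suc k))
    split : ∀ k x y → suc (suc k) * (x + y) ≡ x + (suc k * x + suc (suc k) * y)
    split = solve-∀

  binom-suc : ∀ n k → suc n * binom (suc n) k ≡ suc n * binom n k + k * binom (suc n) k
  binom-suc n zero    = sym (+-identityʳ (suc n * 1))
  binom-suc n (suc k) = begin
    suc n * (binom n k + binom n (suc k))                   ≡⟨ *-distribˡ-+ (suc n) (binom n k) _ ⟩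
    suc n * binom n k + suc n * binom n (suc k)             ≡⟨ +-comm (suc n * binom n k) _ ⟩
    suc n * binom n (suc k) + suc n * binom n k             ≡⟨ cong (suc n * binom n (suc k) +_) (sym (binom-absorb n k)) ⟩
    suc n * binom n (suc k) + suc k * binom (suc n) (suc k) ∎
    where open ≡-Reasoning

  binom-pos : ∀ {n k} → k ≤ n → 0 < binom n k
  binom-pos {n}     {zero}  _         = s≤s z≤n
  binom-pos {suc n} {suc k} (s≤s k≤n) = ≤-trans (binom-pos k≤n) (m≤m+n _ _)

  binom[1+n,1+k]≥1+n : ∀ {n k} → k < n → suc n ≤ binom (suc n) (suc k)
  binom[1+n,1+k]≥1+n {n}     {zero}  _         = s≤s (≤-reflexive (sym (binom-1 n)))
  binom[1+n,1+k]≥1+n {suc n} {suc k} (s≤s k<n) =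
    subst (_≤ binom (suc n) (suc k) + binom (suc n) (suc (suc k))) (+-comm (suc n) 1)
          (+-mono-≤ (binom[1+n,1+k]≥1+n k<n) (binom-pos (s≤s k<n)))

  binom[n,k]≤binom[1+n,k] : ∀ n k → binom n k ≤ binom (suc n) k
  binom[n,k]≤binom[1+n,k] n zero    = ≤-refl
  binom[n,k]≤binom[1+n,k] n (suc k) = m≤n+m (binom n (suc k)) (binom n k)

  binom-odd-centre : ∀ r → suc (double r) ≤ binom (suc (double r)) r
  binom-odd-centre zero    = ≤-refl
  binom-odd-centre (suc r) = binom[1+n,1+k]≥1+n (s≤s (≤-trans (n≤double r) (n≤1+n _)))

  central-bound-even : ∀ r → (1 + 2 * r) * (6 + 4 * r) ≤ (2 + 2 * r) * binom (3 + double r) (suc r)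
  central-bound-even r = begin
    (1 + 2 * r) * (6 + 4 * r)                                    ≡⟨ regroup₁ r ⟩
    2 * ((3 + double r) * suc (double r))                        ≤⟨ *-monoʳ-≤ 2 (*-monoʳ-≤ (3 + double r)
                                                                      (≤-trans (binom-odd-centre r) (binom[n,k]≤binom[1+n,k] _ r))) ⟩
    2 * ((3 + double r) * binom (2 + double r) r)                ≡⟨ cong (2 *_) (binom-absorb (2 + double r) r) ⟨
    2 * (suc r * binom (3 + double r) (suc r))                   ≡⟨ regroup₂ r (binom (3 + double r) (suc r)) ⟩
    (2 + 2 * r) * binom (3 + double r) (suc r)                   ∎
    where
    open ≤-Reasoning
    regroup₁ : ∀ r → (1 + 2 * r) * (6 + 4 * r) ≡ 2 * ((3 + double r) * suc (double r))
    regroup₁ r rewrite double≡+ r = polynomial r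
      where
      polynomial : ∀ r → (1 + 2 * r) * (6 + 4 * r) ≡ 2 * ((3 + (r + r)) * suc (r + r))
      polynomial = solve-∀
    regroup₂ : ∀ r x → 2 * (suc r * x) ≡ (2 + 2 * r) * x
    regroup₂ = solve-∀

  central-bound-odd : ∀ k → 2 + 4 * k ≤ binom (2 + double k) (suc k)
  central-bound-odd k = *-cancelˡ-≤ (suc k) (begin
    suc k * (2 + 4 * k)                       ≡⟨ regroup₁ k ⟩
    (2 + double k) * suc (double k)           ≤⟨ *-monoʳ-≤ (2 + double k) (binom-odd-centre k) ⟩
    (2 + double k) * binom (suc (double k)) k ≡⟨ binom-absorb (suc (double k)) k ⟨
    suc k * binom (2 + double k) (suc k)      ∎)
    where
    open ≤-Reasoning
    regroup₁ : ∀ k → suc k * (2 + 4 * k) ≡ (2 + double k) * suc (double k)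
    regroup₁ k rewrite double≡+ k = polynomial k
      where
      polynomial : ∀ k → suc k * (2 + 4 * k) ≡ (2 + (k + k)) * suc (k + k)
      polynomial = solve-∀

module IntegerBinomials where

  open import Data.Nat as ℕ using (ℕ; zero; suc)
  import Data.Nat.Properties as ℕ
  open import Data.Integer using (ℤ; +_; _+_; _-_; _*_; 1ℤ)
  open import Data.Integer.Properties using (pos-+; pos-*; *-zeroʳ; +-assoc)
  open import Data.Integer.Tactic.RingSolver using (solve-∀)
  open import Relation.Binary.PropositionalEquality
  open Binomials

  B : ℕ → ℕ → ℤ
  B n k = + binom n k

  pos-suc : ∀ n → + suc n ≡ + n + 1ℤ
  pos-suc n = trans (cong +_ (ℕ.+-comm 1 n)) (pos-+ n 1)

  pos-suc+1 : ∀ n → + suc n + 1ℤ ≡ + n + + 2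
  pos-suc+1 n = trans (cong (_+ 1ℤ) (pos-suc n)) (+-assoc (+ n) 1ℤ 1ℤ)

  pos-2+ : ∀ n → + suc (suc n) ≡ + n + + 2
  pos-2+ n = trans (pos-suc (suc n)) (pos-suc+1 n)

  pos-double : ∀ n → + double n ≡ + n + + n
  pos-double n = trans (cong +_ (double≡+ n)) (pos-+ n n)

  pos-double+1 : ∀ n → + suc (double n) ≡ + n + + n + 1ℤ
  pos-double+1 n = trans (pos-suc (double n)) (cong (_+ 1ℤ) (pos-double n))

  pos-double+2 : ∀ n → + suc (suc (double n)) ≡ + n + + n + + 2
  pos-double+2 n = trans (pos-2+ (double n)) (cong (_+ + 2) (pos-double n))

  pos-+1 : ∀ m n → + suc (m ℕ.+ n) ≡ + m + + n + 1ℤ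
  pos-+1 m n = trans (pos-suc (m ℕ.+ n)) (cong (_+ 1ℤ) (pos-+ m n))

  pos-+2 : ∀ m n → + suc (suc (m ℕ.+ n)) ≡ + m + + n + + 2
  pos-+2 m n = trans (pos-2+ (m ℕ.+ n)) (cong (_+ + 2) (pos-+ m n))

  pos-suc-* : ∀ n x → + (suc n ℕ.* x) ≡ (+ n + 1ℤ) * + x
  pos-suc-* n x = trans (pos-* (suc n) x) (cong (_* + x) (pos-suc n))

  compose-ratios : ∀ p q r s x y z → p * x ≡ q * y → r * y ≡ s * z → r * p * x ≡ q * s * z
  compose-ratios p q r s x y z e f = begin
    r * p * x   ≡⟨ reassoc r p x ⟩
    r * (p * x) ≡⟨ cong (r *_) e ⟩
    r * (q * y) ≡⟨ swap r q y ⟩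
    q * (r * y) ≡⟨ cong (q *_) f ⟩
    q * (s * z) ≡⟨ reassoc q s z ⟨
    q * s * z   ∎
    where
    open ≡-Reasoning
    reassoc : ∀ a b c → a * b * c ≡ a * (b * c)
    reassoc = solve-∀
    swap : ∀ a b c → a * (b * c) ≡ b * (a * c)
    swap = solve-∀

  B-absorb : ∀ n k → (+ k + 1ℤ) * B (suc n) (suc k) ≡ (+ n + 1ℤ) * B n k
  B-absorb n k = begin
    (+ k + 1ℤ) * B (suc n) (suc k)      ≡⟨ pos-suc-* k _ ⟨
    + (suc k ℕ.* binom (suc n) (suc k)) ≡⟨ cong +_ (binom-absorb n k) ⟩
    + (suc n ℕ.* binom n k)             ≡⟨ pos-suc-* n _ ⟩
    (+ n + 1ℤ) * B n k                  ∎
    where open ≡-Reasoning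

  B-shift : ∀ n k → (+ n + 1ℤ) * B n k ≡ (+ n + 1ℤ - + k) * B (suc n) k
  B-shift n k = rearrange (+ n + 1ℤ) (+ k) (B n k) (B (suc n) k) (begin
    (+ n + 1ℤ) * B (suc n) k                           ≡⟨ pos-suc-* n _ ⟨
    + (suc n ℕ.* binom (suc n) k)                      ≡⟨ cong +_ (binom-suc n k) ⟩
    + (suc n ℕ.* binom n k ℕ.+ k ℕ.* binom (suc n) k)  ≡⟨ pos-+ (suc n ℕ.* binom n k) _ ⟩
    + (suc n ℕ.* binom n k) + + (k ℕ.* binom (suc n) k) ≡⟨ cong₂ _+_ (pos-suc-* n _) (pos-* k _) ⟩
    (+ n + 1ℤ) * B n k + + k * B (suc n) k             ∎)
    where
    open ≡-Reasoning
    rearrange : ∀ N K x y → N * y ≡ N * x + K * y → N * x ≡ (N - K) * y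
    rearrange N K x y e = begin
      N * x                   ≡⟨ cancel N K x y ⟩
      (N * x + K * y) - K * y ≡⟨ cong (_- K * y) e ⟨
      N * y - K * y           ≡⟨ factor N K y ⟩
      (N - K) * y             ∎
      where
      cancel : ∀ N K x y → N * x ≡ (N * x + K * y) - K * y
      cancel = solve-∀
      factor : ∀ N K y → N * y - K * y ≡ (N - K) * y
      factor = solve-∀

  B-pred : ∀ n k → + n * B (n ℕ.∸ 1) k ≡ (+ n - + k) * B n k
  B-pred zero    zero    = refl
  B-pred zero    (suc k) = sym (*-zeroʳ (+ 0 - + suc k))
  B-pred (suc n) k =
    subst (λ N → N * B n k ≡ (N - + k) * B (suc n) k) (sym (pos-suc n)) (B-shift n k)

  B-absorb₂ : ∀ n k → (+ n + + 2) * B (suc n) k ≡ (+ k + 1ℤ) * B (suc (suc n)) (suc k)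
  B-absorb₂ n k =
    subst (λ N → N * B (suc n) k ≡ (+ k + 1ℤ) * B (suc (suc n)) (suc k)) (pos-suc+1 n) (sym (B-absorb (suc n) k))

  B-shift₂ : ∀ n k → (+ n + + 2) * B (suc n) k ≡ (+ n + + 2 - + k) * B (suc (suc n)) k
  B-shift₂ n k =
    subst (λ N → N * B (suc n) k ≡ (N - + k) * B (suc (suc n)) k) (pos-suc+1 n) (B-shift (suc n) k)

  B-descend₂ : ∀ n k → (+ n + + 2) * (+ n + 1ℤ) * B n k
                       ≡ (+ n + 1ℤ - + k) * (+ n + + 2 - + k) * B (suc (suc n)) k
  B-descend₂ n k = compose-ratios (+ n + 1ℤ) (+ n + 1ℤ - + k) (+ n + + 2) (+ n + + 2 - + k)
                         (B n k) (B (suc n) k) (B (suc (suc n)) k) (B-shift n k) (B-shift₂ n k)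

  B-descend₃ : ∀ n k → (+ n + + 2) * (+ n + 1ℤ) * + n * B (n ℕ.∸ 1) k
                       ≡ (+ n - + k) * ((+ n + 1ℤ - + k) * (+ n + + 2 - + k)) * B (suc (suc n)) k
  B-descend₃ n k = compose-ratios (+ n) (+ n - + k) ((+ n + + 2) * (+ n + 1ℤ)) ((+ n + 1ℤ - + k) * (+ n + + 2 - + k))
                         (B (n ℕ.∸ 1) k) (B n k) (B (suc (suc n)) k) (B-pred n k) (B-descend₂ n k)

  B-descend₂′ : ∀ n h → (+ n + + 2) * (+ n + 1ℤ) * B n h
                        ≡ (+ n + 1ℤ - + h) * (+ h + 1ℤ) * B (suc (suc n)) (suc h)
  B-descend₂′ n h = compose-ratios (+ n + 1ℤ) (+ n + 1ℤ - + h) (+ n + + 2) (+ h + 1ℤ)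
                          (B n h) (B (suc n) h) (B (suc (suc n)) (suc h)) (B-shift n h) (B-absorb₂ n h)

  B-descend₃′ : ∀ n h → (+ n + + 2) * (+ n + 1ℤ) * + n * B (n ℕ.∸ 1) h
                        ≡ (+ n - + h) * ((+ n + 1ℤ - + h) * (+ h + 1ℤ)) * B (suc (suc n)) (suc h)
  B-descend₃′ n h = compose-ratios (+ n) (+ n - + h) ((+ n + + 2) * (+ n + 1ℤ)) ((+ n + 1ℤ - + h) * (+ h + 1ℤ))
                          (B (n ℕ.∸ 1) h) (B n h) (B (suc (suc n)) (suc h)) (B-pred n h) (B-descend₂′ n h)

  B-shift₂′ : ∀ n h → (+ n + + 2) * B (suc n) (suc h) ≡ (+ n + + 2 - (+ h + 1ℤ)) * B (suc (suc n)) (suc h)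
  B-shift₂′ n h =
    subst (λ H → (+ n + + 2) * B (suc n) (suc h) ≡ (+ n + + 2 - H) * B (suc (suc n)) (suc h))
          (pos-suc h) (B-shift₂ n (suc h))

module CreativeTelescoping where

  open import Data.Integer using (ℤ; +_; -_; _+_; _-_; _*_; 0ℤ; 1ℤ)
  open import Data.Integer.Tactic.RingSolver using (solve-∀)
  open import Relation.Binary.PropositionalEquality

  -- Coefficients of the recurrence  α a i · a · e(i+1) + γ a · i · e(i-1) = β a i j · e(i)
  -- for e(i) = E_j(i) at n = 2d + 1, where a = d - i.  The INLINE pragmas make these
  -- abbreviations transparent to the ring solver.
  α : ℤ → ℤ → ℤ
  α a i = (+ 2 * a + i + + 2) * (+ 2 * a + + 3)
  {-# INLINE α #-}

  γ : ℤ → ℤ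
  γ a = (a + + 2) * (+ 2 * a + 1ℤ)
  {-# INLINE γ #-}

  β : ℤ → ℤ → ℤ → ℤ
  β a i j = α a i * a + γ a * i - + 2 * j * (+ 2 * a + 1ℤ) * (+ 2 * a + + 3)
  {-# INLINE β #-}

  -- Creative-telescoping certificate: (i+1)(a+1) times the h-th summand of the recurrence is
  -- G(h+1) - G(h), where G(h) = (-1)^h h R a i j h C(i+1,h) C(a,j-h) C(a+1,j-h).
  R : ℤ → ℤ → ℤ → ℤ → ℤ
  R a i j h =
      - + 4 - + 4 * i + (+ 9 + + 6 * i) * j - (+ 6 + + 3 * i) * j * j
    - (+ 5 + + 6 * i) * h + (+ 9 + + 6 * i) * h * j - (+ 3 + + 3 * i) * h * h
    + a * ( - + 21 - + 18 * i + (+ 30 + + 16 * i) * j - (+ 10 + + 2 * i) * j * j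
            - (+ 15 + + 16 * i) * h + (+ 12 + + 4 * i) * h * j - (+ 2 + + 2 * i) * h * h)
    + a * a * ( - + 33 - + 22 * i + (+ 28 + + 8 * i) * j - + 4 * j * j
                - (+ 11 + + 8 * i) * h + + 4 * h * j)
    + a * a * a * ( - + 20 - + 8 * i + + 8 * j - + 2 * h)
    - + 4 * a * a * a * a
  {-# INLINE R #-}

  -- That relation at h, in terms of the five binomial products it involves.
  Ψ : (a i j h s₁ s₂ s₃ s₄ s₅ : ℤ) → ℤ
  Ψ a i j h s₁ s₂ s₃ s₄ s₅ =
      (i + 1ℤ) * (a + 1ℤ) * (α a i * s₁ + γ a * s₂ - β a i j * s₃)
    + (h + 1ℤ) * R a i j (h + 1ℤ) * s₄
    + h * R a i j h * s₅
  {-# INLINE Ψ #-}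

  -- Clears the denominators when those products are expressed through two base binomials.
  scale : ℤ → ℤ → ℤ
  scale a i = (i + 1ℤ) * (i + + 2) * (a + 1ℤ) * (a + 1ℤ) * (a + + 2) * (a + + 2)
  {-# INLINE scale #-}

  certificate : ∀ a i h k y₂ Bi →
    Ψ a i (h + k) h ((i + 1ℤ) * ((h + 1ℤ) * Bi) * ((a - k) * ((a + 1ℤ - k) * (a + + 2 - k)) * y₂)
                          * ((a + 1ℤ - k) * (a + + 2 - k) * y₂))
              ((a + 1ℤ) * (a + 1ℤ) * (a + + 2) * ((i - h) * ((i + 1ℤ - h) * (h + 1ℤ)) * Bi)
                          * ((a + + 2 - k) * y₂) * y₂)
              ((a + 1ℤ) * ((i + 1ℤ - h) * (h + 1ℤ) * Bi) * ((a + 1ℤ - k) * (a + + 2 - k) * y₂)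
                          * ((a + + 2 - k) * y₂))
              ((i + 1ℤ) * (a + 1ℤ) * ((i + + 2 - (h + 1ℤ)) * Bi) * (k * (a + + 2 - k) * k * (y₂ * y₂)))
              ((i + 1ℤ) * (a + 1ℤ) * ((h + 1ℤ) * Bi) * ((a + 1ℤ - k) * (a + + 2 - k) * y₂)
                          * ((a + + 2 - k) * y₂))
    ≡ 0ℤ
  certificate = solve-∀

  Ψ-scale : ∀ a i j h s t₁ t₂ t₃ t₄ t₅ →
    s * Ψ a i j h t₁ t₂ t₃ t₄ t₅ ≡ Ψ a i j h (s * t₁) (s * t₂) (s * t₃) (s * t₄) (s * t₅)
  Ψ-scale = solve-∀

  Ψ-cong : ∀ a i j h {s₁ s₂ s₃ s₄ s₅ t₁ t₂ t₃ t₄ t₅} →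
    s₁ ≡ t₁ → s₂ ≡ t₂ → s₃ ≡ t₃ → s₄ ≡ t₄ → s₅ ≡ t₅ →
    Ψ a i j h s₁ s₂ s₃ s₄ s₅ ≡ Ψ a i j h t₁ t₂ t₃ t₄ t₅
  Ψ-cong a i j h refl refl refl refl refl = refl

  rescale₁ : ∀ a i x₁ yₘ y₀ → scale a i * (x₁ * (a * yₘ) * y₀)
    ≡ (i + 1ℤ) * ((i + + 2) * x₁) * ((a + + 2) * (a + 1ℤ) * a * yₘ) * ((a + + 2) * (a + 1ℤ) * y₀)
  rescale₁ = solve-∀

  rescale₂ : ∀ a i xₘ y₁ y₂ → scale a i * (i * xₘ * y₁ * y₂)
    ≡ (a + 1ℤ) * (a + 1ℤ) * (a + + 2) * ((i + + 2) * (i + 1ℤ) * i * xₘ) * ((a + + 2) * y₁) * y₂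
  rescale₂ = solve-∀

  rescale₃ : ∀ a i x₀ y₀ y₁ → scale a i * (x₀ * y₀ * y₁)
    ≡ (a + 1ℤ) * ((i + + 2) * (i + 1ℤ) * x₀) * ((a + + 2) * (a + 1ℤ) * y₀) * ((a + + 2) * y₁)
  rescale₃ = solve-∀

  rescale₄ : ∀ a i x₁′ Y → scale a i * (x₁′ * Y)
    ≡ (i + 1ℤ) * (a + 1ℤ) * ((i + + 2) * x₁′) * ((a + 1ℤ) * (a + + 2) * (a + + 2) * Y)
  rescale₄ = solve-∀

  rescale₅ : ∀ a i x₁ y₀ y₁ → scale a i * (x₁ * (y₀ * y₁))
    ≡ (i + 1ℤ) * (a + 1ℤ) * ((i + + 2) * x₁) * ((a + + 2) * (a + 1ℤ) * y₀) * ((a + + 2) * y₁)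
  rescale₅ = solve-∀

  telescoping-identity : ∀ a i h k x₁ x₀ xₘ x₁′ y₀ y₁ y₂ yₘ Y Bi →
    (i + + 2) * x₁ ≡ (h + 1ℤ) * Bi →
    (i + + 2) * (i + 1ℤ) * i * xₘ ≡ (i - h) * ((i + 1ℤ - h) * (h + 1ℤ)) * Bi →
    (i + + 2) * (i + 1ℤ) * x₀ ≡ (i + 1ℤ - h) * (h + 1ℤ) * Bi →
    (i + + 2) * x₁′ ≡ (i + + 2 - (h + 1ℤ)) * Bi →
    (a + + 2) * y₁ ≡ (a + + 2 - k) * y₂ →
    (a + + 2) * (a + 1ℤ) * y₀ ≡ (a + 1ℤ - k) * (a + + 2 - k) * y₂ →
    (a + + 2) * (a + 1ℤ) * a * yₘ ≡ (a - k) * ((a + 1ℤ - k) * (a + + 2 - k)) * y₂ →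
    (a + 1ℤ) * (a + + 2) * (a + + 2) * Y ≡ k * (a + + 2 - k) * k * (y₂ * y₂) →
    scale a i * Ψ a i (h + k) h (x₁ * (a * yₘ) * y₀) (i * xₘ * y₁ * y₂) (x₀ * y₀ * y₁) (x₁′ * Y) (x₁ * (y₀ * y₁))
    ≡ 0ℤ
  telescoping-identity a i h k x₁ x₀ xₘ x₁′ y₀ y₁ y₂ yₘ Y Bi e₁ eₘ e₀ e₁′ f₁ f₀ fₘ fY = begin
    scale a i * Ψ a i (h + k) h T₁ T₂ T₃ T₄ T₅
      ≡⟨ Ψ-scale a i (h + k) h (scale a i) T₁ T₂ T₃ T₄ T₅ ⟩
    Ψ a i (h + k) h (scale a i * T₁) (scale a i * T₂) (scale a i * T₃) (scale a i * T₄) (scale a i * T₅)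
      ≡⟨ Ψ-cong a i (h + k) h
           (trans (rescale₁ a i x₁ yₘ y₀) (cong₃ (λ u v w → (i + 1ℤ) * u * v * w) e₁ fₘ f₀))
           (trans (rescale₂ a i xₘ y₁ y₂) (cong₂ (λ u v → (a + 1ℤ) * (a + 1ℤ) * (a + + 2) * u * v * y₂) eₘ f₁))
           (trans (rescale₃ a i x₀ y₀ y₁) (cong₃ (λ u v w → (a + 1ℤ) * u * v * w) e₀ f₀ f₁))
           (trans (rescale₄ a i x₁′ Y) (cong₂ (λ u v → (i + 1ℤ) * (a + 1ℤ) * u * v) e₁′ fY))
           (trans (rescale₅ a i x₁ y₀ y₁) (cong₃ (λ u v w → (i + 1ℤ) * (a + 1ℤ) * u * v * w) e₁ f₀ f₁)) ⟩
    _ ≡⟨ certificate a i h k y₂ Bi ⟩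
    0ℤ ∎
    where
    open ≡-Reasoning
    T₁ = x₁ * (a * yₘ) * y₀
    T₂ = i * xₘ * y₁ * y₂
    T₃ = x₀ * y₀ * y₁
    T₄ = x₁′ * Y
    T₅ = x₁ * (y₀ * y₁)
    cong₃ : ∀ (f : ℤ → ℤ → ℤ → ℤ) {u u′ v v′ w w′} → u ≡ u′ → v ≡ v′ → w ≡ w′ → f u v w ≡ f u′ v′ w′
    cong₃ f refl refl refl = refl

module ThreeTermRecurrence where

  open import Data.Nat as ℕ using (ℕ; zero; suc; _≤_; _<_; z≤n; s≤s)
  import Data.Nat.Properties as ℕ
  open import Data.Integer using (ℤ; +_; -_; _+_; _-_; _*_; 0ℤ; 1ℤ; NonZero)
  open import Data.Integer.Properties as ℤ using (pos-+; pos-*; i*j≢0; *-cancelˡ-≡; *-zeroʳ)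
  open import Data.Integer.Tactic.RingSolver using (solve-∀)
  import Data.Nat.Tactic.RingSolver as ℕ-Solver
  open import Relation.Binary.PropositionalEquality using (_≡_; refl; sym; trans; cong; cong₂; subst; module ≡-Reasoning)
  open import Defs
  open import Data.Nat.Combinatorics using (_C_)
  open Binomials
  open IntegerBinomials
  open CreativeTelescoping

  sumTo-cong : ∀ j {f g : ℕ → ℤ} → (∀ h → h ≤ j → f h ≡ g h) → sumTo j f ≡ sumTo j g
  sumTo-cong zero    f≡g = f≡g 0 z≤n
  sumTo-cong (suc j) f≡g =
    cong₂ _+_ (sumTo-cong j (λ h h≤j → f≡g h (ℕ.m≤n⇒m≤1+n h≤j))) (f≡g (suc j) ℕ.≤-refl)

  sumTo-linear : ∀ j p q r (f g e : ℕ → ℤ) →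
    sumTo j (λ h → p * f h + q * g h - r * e h) ≡ p * sumTo j f + q * sumTo j g - r * sumTo j e
  sumTo-linear zero    p q r f g e = refl
  sumTo-linear (suc j) p q r f g e =
    trans (cong (_+ (p * f (suc j) + q * g (suc j) - r * e (suc j))) (sumTo-linear j p q r f g e))
          (regroup p q r (sumTo j f) (sumTo j g) (sumTo j e) (f (suc j)) (g (suc j)) (e (suc j)))
    where
    regroup : ∀ p q r F G E x y z →
      (p * F + q * G - r * E) + (p * x + q * y - r * z) ≡ p * (F + x) + q * (G + y) - r * (E + z)
    regroup = solve-∀

  sumTo-*ˡ : ∀ j c (f : ℕ → ℤ) → sumTo j (λ h → c * f h) ≡ c * sumTo j f
  sumTo-*ˡ zero    c f = refl
  sumTo-*ˡ (suc j) c f =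
    trans (cong (_+ c * f (suc j)) (sumTo-*ˡ j c f)) (sym (ℤ.*-distribˡ-+ c (sumTo j f) (f (suc j))))

  sumTo-telescope : ∀ m (f g : ℕ → ℤ) → (∀ h → h ≤ m → f h ≡ g (suc h) - g h) →
                    sumTo m f ≡ g (suc m) - g 0
  sumTo-telescope zero    f g step = step 0 z≤n
  sumTo-telescope (suc m) f g step =
    trans (cong₂ _+_ (sumTo-telescope m f g (λ h h≤m → step h (ℕ.m≤n⇒m≤1+n h≤m))) (step (suc m) ℕ.≤-refl))
          (collapse (g (suc (suc m))) (g (suc m)) (g 0))
    where
    collapse : ∀ x y z → (y - z) + (x - y) ≡ x - z
    collapse = solve-∀

  sumTo-zero : ∀ j → sumTo j (λ _ → 0ℤ) ≡ 0ℤ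
  sumTo-zero zero    = refl
  sumTo-zero (suc j) = cong (_+ 0ℤ) (sumTo-zero j)

  sumTo-first : ∀ j (f : ℕ → ℤ) → (∀ h → f (suc h) ≡ 0ℤ) → sumTo j f ≡ f 0
  sumTo-first zero    f _    = refl
  sumTo-first (suc j) f tail = trans (cong₂ _+_ (sumTo-first j f tail) (tail j)) (ℤ.+-identityʳ (f 0))

  sumTo-last : ∀ j (f : ℕ → ℤ) → (∀ h → h < j → f h ≡ 0ℤ) → sumTo j f ≡ f j
  sumTo-last zero    f _    = refl
  sumTo-last (suc j) f init = trans (cong (_+ f (suc j)) (trans (sumTo-cong j (λ h h≤j → init h (s≤s h≤j)))
                                                                (sumTo-zero j)))
                                    (ℤ.+-identityˡ (f (suc j)))

  Eig : ℕ → ℕ → ℕ → ℤ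
  Eig d j i = E (2 ℕ.* d ℕ.+ 1) d j i

  eberleinTerm-B : ∀ d j i h → i ≤ d →
    eberleinTerm (2 ℕ.* d ℕ.+ 1) d j i h ≡ sign h * (B i h * B (d ℕ.∸ i) (j ℕ.∸ h) * B (suc (d ℕ.∸ i)) (j ℕ.∸ h))
  eberleinTerm-B d j i h i≤d = cong (sign h *_) (begin
    + ((i C h) ℕ.* (((d ℕ.∸ i) C (j ℕ.∸ h)) ℕ.* ((2 ℕ.* d ℕ.+ 1 ℕ.∸ d ℕ.∸ i) C (j ℕ.∸ h))))
      ≡⟨ cong (λ m → + ((i C h) ℕ.* (((d ℕ.∸ i) C (j ℕ.∸ h)) ℕ.* (m C (j ℕ.∸ h))))) complement ⟩
    + ((i C h) ℕ.* (((d ℕ.∸ i) C (j ℕ.∸ h)) ℕ.* (suc (d ℕ.∸ i) C (j ℕ.∸ h))))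
      ≡⟨ cong₂ (λ x y → + (x ℕ.* y)) (binom≡C i h)
           (cong₂ ℕ._*_ (binom≡C (d ℕ.∸ i) (j ℕ.∸ h)) (binom≡C (suc (d ℕ.∸ i)) (j ℕ.∸ h))) ⟨
    + (binom i h ℕ.* (binom (d ℕ.∸ i) (j ℕ.∸ h) ℕ.* binom (suc (d ℕ.∸ i)) (j ℕ.∸ h)))
      ≡⟨ pos-*³ (binom i h) _ _ ⟩
    B i h * B (d ℕ.∸ i) (j ℕ.∸ h) * B (suc (d ℕ.∸ i)) (j ℕ.∸ h) ∎)
    where
    open ≡-Reasoning
    complement : 2 ℕ.* d ℕ.+ 1 ℕ.∸ d ℕ.∸ i ≡ suc (d ℕ.∸ i)
    complement = begin
      2 ℕ.* d ℕ.+ 1 ℕ.∸ d ℕ.∸ i  ≡⟨ cong (λ m → m ℕ.∸ d ℕ.∸ i) (shape d) ⟩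
      d ℕ.+ suc d ℕ.∸ d ℕ.∸ i    ≡⟨ cong (ℕ._∸ i) (ℕ.m+n∸m≡n d (suc d)) ⟩
      suc d ℕ.∸ i                ≡⟨ ℕ.+-∸-assoc 1 i≤d ⟩
      suc (d ℕ.∸ i)              ∎
      where
      shape : ∀ d → 2 ℕ.* d ℕ.+ 1 ≡ d ℕ.+ suc d
      shape = ℕ-Solver.solve-∀
    pos-*³ : ∀ x y z → + (x ℕ.* (y ℕ.* z)) ≡ + x * + y * + z
    pos-*³ x y z = trans (pos-* x (y ℕ.* z)) (trans (cong (+ x *_) (pos-* y z)) (sym (ℤ.*-assoc (+ x) (+ y) (+ z))))

  Eig-sum : ∀ d j i → i ≤ d →
    Eig d j i ≡ sumTo j (λ h → sign h * (B i h * B (d ℕ.∸ i) (j ℕ.∸ h) * B (suc (d ℕ.∸ i)) (j ℕ.∸ h)))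
  Eig-sum d j i i≤d = sumTo-cong j (λ h _ → eberleinTerm-B d j i h i≤d)

  -- B a (k-1) · B (a+1) (k-1), but 0 at k = 0: this makes the telescoper vanish at h = j + 1.
  shiftedPair : ℕ → ℕ → ℤ
  shiftedPair a zero    = 0ℤ
  shiftedPair a (suc k) = B a k * B (suc a) k

  shiftedPair-relation : ∀ a k →
    (+ a + 1ℤ) * (+ a + + 2) * (+ a + + 2) * shiftedPair a k
    ≡ + k * (+ a + + 2 - + k) * + k * (B (suc (suc a)) k * B (suc (suc a)) k)
  shiftedPair-relation a zero    = *-zeroʳ ((+ a + 1ℤ) * (+ a + + 2) * (+ a + + 2))
  shiftedPair-relation a (suc k) = begin
    (+ a + 1ℤ) * (+ a + + 2) * (+ a + + 2) * (B a k * B (suc a) k)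
      ≡⟨ regroup₁ (+ a + 1ℤ) (+ a + + 2) (B a k) (B (suc a) k) ⟩
    (+ a + 1ℤ) * B a k * ((+ a + + 2) * B (suc a) k) * (+ a + + 2)
      ≡⟨ cong₂ (λ u v → u * v * (+ a + + 2)) (B-shift a k) (B-absorb₂ a k) ⟩
    (+ a + 1ℤ - + k) * B (suc a) k * ((+ k + 1ℤ) * y) * (+ a + + 2)
      ≡⟨ regroup₂ (+ a + 1ℤ - + k) (+ k + 1ℤ) (+ a + + 2) (B (suc a) k) y ⟩
    (+ a + 1ℤ - + k) * (+ k + 1ℤ) * ((+ a + + 2) * B (suc a) k) * y
      ≡⟨ cong (λ u → (+ a + 1ℤ - + k) * (+ k + 1ℤ) * u * y) (B-absorb₂ a k) ⟩
    (+ a + 1ℤ - + k) * (+ k + 1ℤ) * ((+ k + 1ℤ) * y) * y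
      ≡⟨ regroup₃ (+ a) (+ k) y ⟩
    (+ k + 1ℤ) * (+ a + + 2 - (+ k + 1ℤ)) * (+ k + 1ℤ) * (y * y)
      ≡⟨ cong (λ K → K * (+ a + + 2 - K) * K * (y * y)) (pos-suc k) ⟨
    + suc k * (+ a + + 2 - + suc k) * + suc k * (y * y) ∎
    where
    open ≡-Reasoning
    y = B (suc (suc a)) (suc k)
    regroup₁ : ∀ p q u v → p * q * q * (u * v) ≡ p * u * (q * v) * q
    regroup₁ = solve-∀
    regroup₂ : ∀ c e q v y → c * v * (e * y) * q ≡ c * e * (q * v) * y
    regroup₂ = solve-∀
    regroup₃ : ∀ a k y → (a + 1ℤ - k) * (k + 1ℤ) * ((k + 1ℤ) * y) * y
                         ≡ (k + 1ℤ) * (a + + 2 - (k + 1ℤ)) * (k + 1ℤ) * (y * y)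
    regroup₃ = solve-∀

  *-nonZero : ∀ x y → NonZero x → NonZero y → NonZero (x * y)
  *-nonZero x y nz-x nz-y = i*j≢0 x y {{nz-x}} {{nz-y}}

  pos-suc-nonZero : ∀ n → NonZero (+ n + 1ℤ)
  pos-suc-nonZero n = subst NonZero (pos-suc n) _

  pos-suc+1-nonZero : ∀ n → NonZero (+ n + + 2)
  pos-suc+1-nonZero n = subst NonZero (pos-suc+1 n) (pos-suc-nonZero (suc n))

  scale-nonZero : ∀ a i → NonZero (scale (+ a) (+ i))
  scale-nonZero a i =
    *-nonZero (p₂ * (+ a + + 2)) (+ a + + 2)
      (*-nonZero p₂ (+ a + + 2)
        (*-nonZero (p₁ * (+ a + 1ℤ)) (+ a + 1ℤ)
          (*-nonZero p₁ (+ a + 1ℤ)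
            (*-nonZero (+ i + 1ℤ) (+ i + + 2) (pos-suc-nonZero i) (pos-suc+1-nonZero i))
            (pos-suc-nonZero a))
          (pos-suc-nonZero a))
        (pos-suc+1-nonZero a))
      (pos-suc+1-nonZero a)
    where
    p₁ = (+ i + 1ℤ) * (+ i + + 2)
    p₂ = p₁ * (+ a + 1ℤ) * (+ a + 1ℤ)

  cancel-nonZero : ∀ c {x} → NonZero c → c * x ≡ 0ℤ → x ≡ 0ℤ
  cancel-nonZero c {x} nz cx≡0 = *-cancelˡ-≡ c x 0ℤ {{nz}} (trans cx≡0 (sym (*-zeroʳ c)))

  module Summands (a i j : ℕ) where

    up down mid : ℕ → ℤ
    up   h = sign h * (B (suc i) h * B (a ℕ.∸ 1) (j ℕ.∸ h) * B a (j ℕ.∸ h))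
    down h = sign h * (B (i ℕ.∸ 1) h * B (suc a) (j ℕ.∸ h) * B (suc (suc a)) (j ℕ.∸ h))
    mid  h = sign h * (B i h * B a (j ℕ.∸ h) * B (suc a) (j ℕ.∸ h))

    summand : ℕ → ℤ
    summand h = α (+ a) (+ i) * (+ a * up h) + γ (+ a) * (+ i * down h) - β (+ a) (+ i) (+ j) * mid h

    telescoper : ℕ → ℤ
    telescoper h = sign h * (+ h * R (+ a) (+ i) (+ j) (+ h) * (B (suc i) h * shiftedPair a (suc j ℕ.∸ h)))

    summand-telescopes : ∀ h → h ≤ j →
      (+ i + 1ℤ) * (+ a + 1ℤ) * summand h ≡ telescoper (suc h) - telescoper h
    summand-telescopes h h≤j = begin
      K * summand h
        ≡⟨ pull-sign K (α A I) (γ A) (β A I J) A I s x₁ yₘ y₀ (B (i ℕ.∸ 1) h) y₁ y₂ x₀ ⟩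
      s * (K * (α A I * T₁ + γ A * T₂ - β A I J * T₃))
        ≡⟨ cong (s *_) (isolate Ψ-vanishes) ⟩
      s * (- P₄ - P₅)
        ≡⟨ distribute s P₄ P₅ ⟩
      - s * P₄ - s * P₅
        ≡⟨ cong₂ _-_ (cong (λ H′ → - s * (H′ * R A I J H′ * T₄)) (pos-suc h))
                     (cong (λ p → s * (+ h * R A I J (+ h) * (x₁ * shiftedPair a p))) (ℕ.+-∸-assoc 1 h≤j)) ⟨
      telescoper (suc h) - telescoper h ∎
      where
      open ≡-Reasoning
      k = j ℕ.∸ h
      A = + a
      I = + i
      J = + j
      K = (I + 1ℤ) * (A + 1ℤ)
      s = sign h
      x₁ = B (suc i) h
      x₀ = B i h
      y₀ = B a k
      y₁ = B (suc a) k
      y₂ = B (suc (suc a)) k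
      yₘ = B (a ℕ.∸ 1) k
      T₁ = x₁ * (A * yₘ) * y₀
      T₂ = I * B (i ℕ.∸ 1) h * y₁ * y₂
      T₃ = x₀ * y₀ * y₁
      T₄ = B (suc i) (suc h) * shiftedPair a k
      P₄ = (+ h + 1ℤ) * R A I J (+ h + 1ℤ) * T₄
      P₅ = + h * R A I J (+ h) * (x₁ * (y₀ * y₁))

      h+k≡j : + h + + k ≡ J
      h+k≡j = trans (sym (pos-+ h k)) (cong +_ (ℕ.m+[n∸m]≡n h≤j))

      Ψ-vanishes : Ψ A I J (+ h) T₁ T₂ T₃ T₄ (x₁ * (y₀ * y₁)) ≡ 0ℤ
      Ψ-vanishes = subst (λ J′ → Ψ A I J′ (+ h) T₁ T₂ T₃ T₄ (x₁ * (y₀ * y₁)) ≡ 0ℤ) h+k≡j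
        (cancel-nonZero (scale A I) (scale-nonZero a i)
          (telescoping-identity A I (+ h) (+ k) x₁ x₀ (B (i ℕ.∸ 1) h) (B (suc i) (suc h)) y₀ y₁ y₂ yₘ
             (shiftedPair a k) (B (suc (suc i)) (suc h))
             (B-absorb₂ i h) (B-descend₃′ i h) (B-descend₂′ i h) (B-shift₂′ i h)
             (B-shift₂ a k) (B-descend₂ a k) (B-descend₃ a k) (shiftedPair-relation a k)))

      pull-sign : ∀ K α γ β A I s x₁ yₘ y₀ xₘ y₁ y₂ x₀ →
        K * (α * (A * (s * (x₁ * yₘ * y₀))) + γ * (I * (s * (xₘ * y₁ * y₂))) - β * (s * (x₀ * y₀ * y₁)))
        ≡ s * (K * (α * (x₁ * (A * yₘ) * y₀) + γ * (I * xₘ * y₁ * y₂) - β * (x₀ * y₀ * y₁)))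
      pull-sign = solve-∀
      isolate : ∀ {x p q} → x + p + q ≡ 0ℤ → x ≡ - p - q
      isolate {x} {p} {q} e = trans (shuffle x p q) (trans (cong (λ z → z - p - q) e) (drop-zero p q))
        where
        shuffle : ∀ x p q → x ≡ (x + p + q) - p - q
        shuffle = solve-∀
        drop-zero : ∀ p q → 0ℤ - p - q ≡ - p - q
        drop-zero = solve-∀
      distribute : ∀ s p q → s * (- p - q) ≡ - s * p - s * q
      distribute = solve-∀

    telescoper-vanishes : telescoper (suc j) ≡ 0ℤ
    telescoper-vanishes =
      trans (cong (λ p → sign (suc j) * (c * (B (suc i) (suc j) * shiftedPair a p))) (ℕ.n∸n≡0 j))
            (annihilate (sign (suc j)) c (B (suc i) (suc j)))
      where
      c = + suc j * R (+ a) (+ i) (+ j) (+ suc j)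
      annihilate : ∀ s c x → s * (c * (x * 0ℤ)) ≡ 0ℤ
      annihilate = solve-∀

  module _ (d j i : ℕ) (i<d : i < d) where

    open Summands (d ℕ.∸ i) i j

    private
      d∸i≡1+d∸1+i : d ℕ.∸ i ≡ suc (d ℕ.∸ suc i)
      d∸i≡1+d∸1+i = ℕ.+-∸-assoc 1 i<d

    up-sum : sumTo j up ≡ Eig d j (suc i)
    up-sum = subst (λ a → sumTo j (λ h → sign h * (B (suc i) h * B (a ℕ.∸ 1) (j ℕ.∸ h) * B a (j ℕ.∸ h)))
                          ≡ Eig d j (suc i))
                   (sym d∸i≡1+d∸1+i) (sym (Eig-sum d j (suc i) i<d))

    mid-sum : sumTo j mid ≡ Eig d j i
    mid-sum = sym (Eig-sum d j i (ℕ.<⇒≤ i<d))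

  down-sum : ∀ d j i → i < d → + i * sumTo j (Summands.down (d ℕ.∸ i) i j) ≡ + i * Eig d j (i ℕ.∸ 1)
  down-sum d j zero    _   = refl
  down-sum d j (suc i) i<d = cong (+ suc i *_)
    (subst (λ a → sumTo j (λ h → sign h * (B i h * B a (j ℕ.∸ h) * B (suc a) (j ℕ.∸ h))) ≡ Eig d j i)
           (ℕ.+-∸-assoc 1 (ℕ.<⇒≤ i<d)) (sym (Eig-sum d j i (ℕ.<⇒≤ (ℕ.<-trans (ℕ.n<1+n i) i<d)))))

  recurrence : ∀ d j i → i < d →
    α (+ (d ℕ.∸ i)) (+ i) * (+ (d ℕ.∸ i) * Eig d j (suc i)) + γ (+ (d ℕ.∸ i)) * (+ i * Eig d j (i ℕ.∸ 1))
      - β (+ (d ℕ.∸ i)) (+ i) (+ j) * Eig d j i ≡ 0ℤ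
  recurrence d j i i<d = cancel-nonZero K (*-nonZero (+ i + 1ℤ) (+ a + 1ℤ) (pos-suc-nonZero i) (pos-suc-nonZero a)) (begin
    K * (α A I * (A * Eig d j (suc i)) + γ A * (I * Eig d j (i ℕ.∸ 1)) - β A I J * Eig d j i)
      ≡⟨ cong (K *_) combination ⟨
    K * sumTo j summand                        ≡⟨ sumTo-*ˡ j K summand ⟨
    sumTo j (λ h → K * summand h)              ≡⟨ sumTo-telescope j _ telescoper summand-telescopes ⟩
    telescoper (suc j) - telescoper 0          ≡⟨ cong (_- 0ℤ) telescoper-vanishes ⟩
    0ℤ                                         ∎)
    where
    open ≡-Reasoning
    open Summands (d ℕ.∸ i) i j
    a = d ℕ.∸ i
    A = + a
    I = + i
    J = + j
    K = (I + 1ℤ) * (A + 1ℤ)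
    combination : sumTo j summand ≡ α A I * (A * Eig d j (suc i)) + γ A * (I * Eig d j (i ℕ.∸ 1)) - β A I J * Eig d j i
    combination = begin
      sumTo j summand
        ≡⟨ sumTo-linear j (α A I) (γ A) (β A I J) (λ h → A * up h) (λ h → I * down h) mid ⟩
      α A I * sumTo j (λ h → A * up h) + γ A * sumTo j (λ h → I * down h) - β A I J * sumTo j mid
        ≡⟨ cong₂ (λ u w → α A I * u + γ A * w - β A I J * sumTo j mid) (sumTo-*ˡ j A up) (sumTo-*ˡ j I down) ⟩
      α A I * (A * sumTo j up) + γ A * (I * sumTo j down) - β A I J * sumTo j mid
        ≡⟨ cong₂ (λ u w → α A I * (A * u) + γ A * w - β A I J * sumTo j mid) (up-sum d j i i<d) (down-sum d j i i<d) ⟩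
      α A I * (A * Eig d j (suc i)) + γ A * (I * Eig d j (i ℕ.∸ 1)) - β A I J * sumTo j mid
        ≡⟨ cong (λ m → α A I * (A * Eig d j (suc i)) + γ A * (I * Eig d j (i ℕ.∸ 1)) - β A I J * m) (mid-sum d j i i<d) ⟩
      α A I * (A * Eig d j (suc i)) + γ A * (I * Eig d j (i ℕ.∸ 1)) - β A I J * Eig d j i ∎

module Factorization where

  open import Data.Nat as ℕ using (ℕ; zero; suc; _<_)
  import Data.Nat.Properties as ℕ
  import Data.Nat.Tactic.RingSolver as ℕ-Solver
  open import Data.Integer using (ℤ; +_; -_; _+_; _-_; _*_; 0ℤ; 1ℤ; NonZero)
  open import Data.Integer.Properties as ℤ using (pos-+; *-cancelˡ-≡; ∣-i∣≡∣i∣)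
  open import Data.Integer.Tactic.RingSolver using (solve-∀)
  open import Function using (_∘_)
  open import Relation.Binary.PropositionalEquality using (_≡_; refl; sym; trans; cong; cong₂; subst; module ≡-Reasoning)
  open Binomials using (double; double-+)
  open IntegerBinomials using (pos-suc; pos-double+1; pos-double+2; pos-+1; pos-+2)
  open CreativeTelescoping using (α; β; γ)
  open ThreeTermRecurrence using (Eig; recurrence; *-nonZero)

  factor-step : ∀ (c p q p₀ q₀ a g b A I x₀ x₁ x₂ : ℤ) → NonZero c →
    c * p ≡ q₀ * (a * A) → c * q ≡ q₀ * b - g * I * p₀ →
    a * (A * x₂) + g * (I * x₀) - b * x₁ ≡ 0ℤ → p₀ * x₁ ≡ q₀ * x₀ → p * x₂ ≡ q * x₁
  factor-step c p q p₀ q₀ a g b A I x₀ x₁ x₂ nz cp≡ cq≡ rec prev = *-cancelˡ-≡ c (p * x₂) (q * x₁) {{nz}} (begin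
    c * (p * x₂)                                             ≡⟨ assoc c p x₂ ⟩
    c * p * x₂                                               ≡⟨ cong (_* x₂) cp≡ ⟩
    q₀ * (a * A) * x₂                                        ≡⟨ expand q₀ a A x₂ g I x₀ b x₁ ⟩
    q₀ * (a * (A * x₂) + g * (I * x₀) - b * x₁) + q₀ * b * x₁ - g * I * (q₀ * x₀)
      ≡⟨ cong₂ (λ u v → q₀ * u + q₀ * b * x₁ - g * I * v) rec (sym prev) ⟩
    q₀ * 0ℤ + q₀ * b * x₁ - g * I * (p₀ * x₁)                ≡⟨ collect q₀ b x₁ g I p₀ ⟩
    (q₀ * b - g * I * p₀) * x₁                               ≡⟨ cong (_* x₁) cq≡ ⟨
    c * q * x₁                                               ≡⟨ assoc c q x₁ ⟨
    c * (q * x₁)                                             ∎)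
    where
    open ≡-Reasoning
    assoc : ∀ x y z → x * (y * z) ≡ x * y * z
    assoc = solve-∀
    expand : ∀ q₀ a A x₂ g I x₀ b x₁ →
      q₀ * (a * A) * x₂ ≡ q₀ * (a * (A * x₂) + g * (I * x₀) - b * x₁) + q₀ * b * x₁ - g * I * (q₀ * x₀)
    expand = solve-∀
    collect : ∀ q₀ b x₁ g I p₀ → q₀ * 0ℤ + q₀ * b * x₁ - g * I * (p₀ * x₁) ≡ (q₀ * b - g * I * p₀) * x₁
    collect = solve-∀

  -- Every first-order coefficient below is, up to sign, a product of such affine forms in
  -- M = + m, R = + r with positive constant term; affℕ is its value.
  aff : ℕ → ℕ → ℕ → ℤ → ℤ → ℤ
  aff c a b M R = + suc c + + a * M + + b * R
  {-# INLINE aff #-}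

  affℕ : ℕ → ℕ → ℕ → ℕ → ℕ → ℕ
  affℕ c a b m r = suc c ℕ.+ a ℕ.* m ℕ.+ b ℕ.* r
  {-# INLINE affℕ #-}

  aff≡pos : ∀ c a b m r → aff c a b (+ m) (+ r) ≡ + affℕ c a b m r
  aff≡pos c a b m r = sym (trans (pos-+ (suc c ℕ.+ a ℕ.* m) (b ℕ.* r))
    (cong₂ _+_ (trans (pos-+ (suc c) (a ℕ.* m)) (cong (_+_ (+ suc c)) (ℤ.pos-* a m))) (ℤ.pos-* b r)))

  aff-nonZero : ∀ c a b m r → NonZero (aff c a b (+ m) (+ r))
  aff-nonZero c a b m r = subst NonZero (sym (aff≡pos c a b m r)) _

  neg-nonZero : ∀ x → NonZero x → NonZero (- x)
  neg-nonZero x nz = subst ℕ.NonZero (sym (∣-i∣≡∣i∣ x)) nz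

  recurrence-at : ∀ d j i a {A I J} → d ≡ i ℕ.+ suc a → + suc a ≡ A → + i ≡ I → + j ≡ J →
    α A I * (A * Eig d j (suc i)) + γ A * (I * Eig d j (i ℕ.∸ 1)) - β A I J * Eig d j i ≡ 0ℤ
  recurrence-at d j i a refl refl refl refl =
    subst (λ x → α (+ x) (+ i) * (+ x * Eig d j (suc i)) + γ (+ x) * (+ i * Eig d j (i ℕ.∸ 1))
                 - β (+ x) (+ i) (+ j) * Eig d j i ≡ 0ℤ)
          (ℕ.m+n∸m≡n i (suc a)) (recurrence d j i (ℕ.m<m+n i (ℕ.s≤s ℕ.z≤n)))

  module EvenDegree (k : ℕ) where

    e : ℕ → ℤ
    e = Eig (double k) k

    even-step : ∀ m r → k ≡ suc (m ℕ.+ r) →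
      aff 5 2 4 (+ m) (+ r) * e (suc (double m)) ≡ aff 0 2 0 (+ m) (+ r) * e (double m)
    odd-step : ∀ m r → k ≡ suc (m ℕ.+ r) →
      aff 0 0 2 (+ m) (+ r) * e (suc (suc (double m))) ≡ - aff 1 0 2 (+ m) (+ r) * e (suc (double m))

    even-step zero r k≡ =
      factor-step c (aff 5 2 4 0ℤ R) (aff 0 2 0 0ℤ R) 1ℤ 1ℤ (α A 0ℤ) (γ A) (β A 0ℤ J) A 0ℤ (e 0) (e 0) (e 1)
        (*-nonZero (aff 1 0 2 0ℤ R) (aff 6 0 4 0ℤ R) (aff-nonZero 1 0 2 0 r) (aff-nonZero 6 0 4 0 r))
        (identity₁ R) (identity₂ R)
        (recurrence-at (double k) k 0 (suc (double r)) (cong double k≡) (pos-double+2 r) refl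
                       (trans (cong +_ k≡) (pos-suc r)))
        refl
      where
      R = + r
      A = R + R + + 2
      J = R + 1ℤ
      c = aff 1 0 2 0ℤ R * aff 6 0 4 0ℤ R
      identity₁ : ∀ R → aff 1 0 2 0ℤ R * aff 6 0 4 0ℤ R * aff 5 2 4 0ℤ R
                        ≡ 1ℤ * (α (R + R + + 2) 0ℤ * (R + R + + 2))
      identity₁ = solve-∀
      identity₂ : ∀ R → aff 1 0 2 0ℤ R * aff 6 0 4 0ℤ R * aff 0 2 0 0ℤ R
                        ≡ 1ℤ * β (R + R + + 2) 0ℤ (R + 1ℤ) - γ (R + R + + 2) * 0ℤ * 1ℤ
      identity₂ = solve-∀
    even-step (suc m) r k≡ =
      subst (λ M′ → aff 5 2 4 M′ R * e (suc (double (suc m))) ≡ aff 0 2 0 M′ R * e (double (suc m)))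
            (sym (pos-suc m))
      (factor-step c (aff 5 2 4 (M + 1ℤ) R) (aff 0 2 0 (M + 1ℤ) R) (aff 0 0 2 M (R + 1ℤ)) (- aff 1 0 2 M (R + 1ℤ))
         (α A I) (γ A) (β A I J) A I (e (suc (double m))) (e (suc (suc (double m)))) (e (suc (suc (suc (double m)))))
         (neg-nonZero (f₁ * f₂ * f₃) (*-nonZero (f₁ * f₂) f₃
            (*-nonZero f₁ f₂ (aff-nonZero 3 0 2 m r) (aff-nonZero 6 0 4 m r)) (aff-nonZero 1 0 2 m r)))
         (identity₁ M R) (identity₂ M R)
         (recurrence-at (double k) k (double (suc m)) (suc (double r))
            (trans (cong double k≡) (trans (cong (λ t → suc (suc (suc (suc t)))) (double-+ m r))
                                           (shape (double m) (double r))))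
            (pos-double+2 r) (pos-double+2 m) (trans (cong +_ k≡) (pos-+2 m r)))
         (subst (λ R′ → aff 0 0 2 M R′ * e (suc (suc (double m))) ≡ - aff 1 0 2 M R′ * e (suc (double m)))
                (pos-suc r) (odd-step m (suc r) (trans k≡ (cong suc (sym (ℕ.+-suc m r)))))))
      where
      M = + m
      R = + r
      A = R + R + + 2
      I = M + M + + 2
      J = M + R + + 2
      f₁ = aff 3 0 2 M R
      f₂ = aff 6 0 4 M R
      f₃ = aff 1 0 2 M R
      c = - (f₁ * f₂ * f₃)
      shape : ∀ x y → suc (suc (suc (suc (x ℕ.+ y)))) ≡ suc (suc x) ℕ.+ suc (suc y)
      shape = ℕ-Solver.solve-∀
      identity₁ : ∀ M R → - (aff 3 0 2 M R * aff 6 0 4 M R * aff 1 0 2 M R) * aff 5 2 4 (M + 1ℤ) R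
                          ≡ - aff 1 0 2 M (R + 1ℤ) * (α (R + R + + 2) (M + M + + 2) * (R + R + + 2))
      identity₁ = solve-∀
      identity₂ : ∀ M R → - (aff 3 0 2 M R * aff 6 0 4 M R * aff 1 0 2 M R) * aff 0 2 0 (M + 1ℤ) R
                          ≡ - aff 1 0 2 M (R + 1ℤ) * β (R + R + + 2) (M + M + + 2) (M + R + + 2)
                            - γ (R + R + + 2) * (M + M + + 2) * aff 0 0 2 M (R + 1ℤ)
      identity₂ = solve-∀

    odd-step m r k≡ =
      factor-step c (aff 0 0 2 M R) (- aff 1 0 2 M R) (aff 5 2 4 M R) (aff 0 2 0 M R)
         (α A I) (γ A) (β A I J) A I (e (double m)) (e (suc (double m))) (e (suc (suc (double m))))
         (*-nonZero (f₁ * f₂) f₃ (*-nonZero f₁ f₂ (aff-nonZero 0 2 0 m r) (aff-nonZero 4 2 4 m r))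
                    (aff-nonZero 4 0 4 m r))
         (identity₁ M R) (identity₂ M R)
         (recurrence-at (double k) k (suc (double m)) (double r)
            (trans (cong double k≡) (trans (cong (λ t → suc (suc t)) (double-+ m r)) (shape (double m) (double r))))
            (pos-double+1 r) (pos-double+1 m) (trans (cong +_ k≡) (pos-+1 m r)))
         (even-step m r k≡)
      where
      M = + m
      R = + r
      A = R + R + 1ℤ
      I = M + M + 1ℤ
      J = M + R + 1ℤ
      f₁ = aff 0 2 0 M R
      f₂ = aff 4 2 4 M R
      f₃ = aff 4 0 4 M R
      c = f₁ * f₂ * f₃
      shape : ∀ x y → suc (suc (x ℕ.+ y)) ≡ suc x ℕ.+ suc y
      shape = ℕ-Solver.solve-∀
      identity₁ : ∀ M R → aff 0 2 0 M R * aff 4 2 4 M R * aff 4 0 4 M R * aff 0 0 2 M R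
                          ≡ aff 0 2 0 M R * (α (R + R + 1ℤ) (M + M + 1ℤ) * (R + R + 1ℤ))
      identity₁ = solve-∀
      identity₂ : ∀ M R → aff 0 2 0 M R * aff 4 2 4 M R * aff 4 0 4 M R * - aff 1 0 2 M R
                          ≡ aff 0 2 0 M R * β (R + R + 1ℤ) (M + M + 1ℤ) (M + R + 1ℤ)
                            - γ (R + R + 1ℤ) * (M + M + 1ℤ) * aff 5 2 4 M R
      identity₂ = solve-∀

  module OddDegree (k : ℕ) where

    e : ℕ → ℤ
    e = Eig (suc (double k)) (suc k)

    even-step : ∀ m r → k ≡ m ℕ.+ r →
      aff 3 2 4 (+ m) (+ r) * aff 0 0 2 (+ m) (+ r) * e (suc (double m))
      ≡ - (aff 0 2 0 (+ m) (+ r) * aff 1 0 2 (+ m) (+ r)) * e (double m)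
    odd-step : ∀ m r → k ≡ suc (m ℕ.+ r) → e (suc (suc (double m))) ≡ e (suc (double m))

    even-step zero r k≡ =
      factor-step (aff 4 0 4 0ℤ R) (aff 3 2 4 0ℤ R * aff 0 0 2 0ℤ R) (- (aff 0 2 0 0ℤ R * aff 1 0 2 0ℤ R)) 1ℤ 1ℤ
        (α A 0ℤ) (γ A) (β A 0ℤ J) A 0ℤ (e 0) (e 0) (e 1)
        (aff-nonZero 4 0 4 0 r) (identity₁ R) (identity₂ R)
        (recurrence-at (suc (double k)) (suc k) 0 (double r) (cong (suc ∘ double) k≡) (pos-double+1 r) refl
                       (trans (cong (+_ ∘ suc) k≡) (pos-suc r)))
        refl
      where
      R = + r
      A = R + R + 1ℤ
      J = R + 1ℤ
      identity₁ : ∀ R → aff 4 0 4 0ℤ R * (aff 3 2 4 0ℤ R * aff 0 0 2 0ℤ R)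
                        ≡ 1ℤ * (α (R + R + 1ℤ) 0ℤ * (R + R + 1ℤ))
      identity₁ = solve-∀
      identity₂ : ∀ R → aff 4 0 4 0ℤ R * - (aff 0 2 0 0ℤ R * aff 1 0 2 0ℤ R)
                        ≡ 1ℤ * β (R + R + 1ℤ) 0ℤ (R + 1ℤ) - γ (R + R + 1ℤ) * 0ℤ * 1ℤ
      identity₂ = solve-∀
    even-step (suc m) r k≡ =
      subst (λ M′ → aff 3 2 4 M′ R * aff 0 0 2 M′ R * e (suc (double (suc m)))
                    ≡ - (aff 0 2 0 M′ R * aff 1 0 2 M′ R) * e (double (suc m)))
            (sym (pos-suc m))
      (factor-step (aff 4 0 4 M R) (aff 3 2 4 (M + 1ℤ) R * aff 0 0 2 (M + 1ℤ) R)
         (- (aff 0 2 0 (M + 1ℤ) R * aff 1 0 2 (M + 1ℤ) R)) 1ℤ 1ℤ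
         (α A I) (γ A) (β A I J) A I (e (suc (double m))) (e (suc (suc (double m)))) (e (suc (suc (suc (double m)))))
         (aff-nonZero 4 0 4 m r) (identity₁ M R) (identity₂ M R)
         (recurrence-at (suc (double k)) (suc k) (double (suc m)) (double r)
            (trans (cong (suc ∘ double) k≡) (trans (cong (λ t → suc (suc (suc t))) (double-+ m r))
                                                   (shape (double m) (double r))))
            (pos-double+1 r) (pos-double+2 m) (trans (cong (+_ ∘ suc) k≡) (pos-+2 m r)))
         (cong (1ℤ *_) (odd-step m r k≡)))
      where
      M = + m
      R = + r
      A = R + R + 1ℤ
      I = M + M + + 2
      J = M + R + + 2
      shape : ∀ x y → suc (suc (suc (x ℕ.+ y))) ≡ suc (suc x) ℕ.+ suc y
      shape = ℕ-Solver.solve-∀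
      identity₁ : ∀ M R → aff 4 0 4 M R * (aff 3 2 4 (M + 1ℤ) R * aff 0 0 2 (M + 1ℤ) R)
                          ≡ 1ℤ * (α (R + R + 1ℤ) (M + M + + 2) * (R + R + 1ℤ))
      identity₁ = solve-∀
      identity₂ : ∀ M R → aff 4 0 4 M R * - (aff 0 2 0 (M + 1ℤ) R * aff 1 0 2 (M + 1ℤ) R)
                          ≡ 1ℤ * β (R + R + 1ℤ) (M + M + + 2) (M + R + + 2) - γ (R + R + 1ℤ) * (M + M + + 2) * 1ℤ
      identity₂ = solve-∀

    odd-step m r k≡ = trans (sym (ℤ.*-identityˡ _)) (trans (factor-step c 1ℤ 1ℤ p₀ q₀
         (α A I) (γ A) (β A I J) A I (e (double m)) (e (suc (double m))) (e (suc (suc (double m))))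
         (neg-nonZero (f₁ * f₂ * f₃ * f₄ * f₅) (*-nonZero (f₁ * f₂ * f₃ * f₄) f₅ (*-nonZero (f₁ * f₂ * f₃) f₄
            (*-nonZero (f₁ * f₂) f₃ (*-nonZero f₁ f₂ (aff-nonZero 0 2 0 m r) (aff-nonZero 3 0 2 m r))
              (aff-nonZero 6 2 4 m r)) (aff-nonZero 6 0 4 m r)) (aff-nonZero 1 0 2 m r)))
         (identity₁ M R) (identity₂ M R)
         (recurrence-at (suc (double k)) (suc k) (suc (double m)) (suc (double r))
            (trans (cong (suc ∘ double) k≡) (trans (cong (λ t → suc (suc (suc t))) (double-+ m r))
                                                   (shape (double m) (double r))))
            (pos-double+2 r) (pos-double+1 m) (trans (cong (+_ ∘ suc) k≡) (pos-+2 m r)))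
         (subst (λ R′ → aff 3 2 4 M R′ * aff 0 0 2 M R′ * e (suc (double m))
                        ≡ - (aff 0 2 0 M R′ * aff 1 0 2 M R′) * e (double m))
                (pos-suc r) (even-step m (suc r) (trans k≡ (sym (ℕ.+-suc m r))))))
      (ℤ.*-identityˡ _))
      where
      M = + m
      R = + r
      A = R + R + + 2
      I = M + M + 1ℤ
      J = M + R + + 2
      p₀ = aff 3 2 4 M (R + 1ℤ) * aff 0 0 2 M (R + 1ℤ)
      q₀ = - (aff 0 2 0 M (R + 1ℤ) * aff 1 0 2 M (R + 1ℤ))
      f₁ = aff 0 2 0 M R
      f₂ = aff 3 0 2 M R
      f₃ = aff 6 2 4 M R
      f₄ = aff 6 0 4 M R
      f₅ = aff 1 0 2 M R
      c = - (f₁ * f₂ * f₃ * f₄ * f₅)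
      shape : ∀ x y → suc (suc (suc (x ℕ.+ y))) ≡ suc x ℕ.+ suc (suc y)
      shape = ℕ-Solver.solve-∀
      identity₁ : ∀ M R → - (aff 0 2 0 M R * aff 3 0 2 M R * aff 6 2 4 M R * aff 6 0 4 M R * aff 1 0 2 M R) * 1ℤ
                          ≡ - (aff 0 2 0 M (R + 1ℤ) * aff 1 0 2 M (R + 1ℤ))
                            * (α (R + R + + 2) (M + M + 1ℤ) * (R + R + + 2))
      identity₁ = solve-∀
      identity₂ : ∀ M R → - (aff 0 2 0 M R * aff 3 0 2 M R * aff 6 2 4 M R * aff 6 0 4 M R * aff 1 0 2 M R) * 1ℤ
                          ≡ - (aff 0 2 0 M (R + 1ℤ) * aff 1 0 2 M (R + 1ℤ))
                            * β (R + R + + 2) (M + M + 1ℤ) (M + R + + 2)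
                            - γ (R + R + + 2) * (M + M + 1ℤ) * (aff 3 2 4 M (R + 1ℤ) * aff 0 0 2 M (R + 1ℤ))
      identity₂ = solve-∀

module Valley where

  open import Data.Nat
  open import Data.Nat.Properties
  open import Data.Nat.Tactic.RingSolver using (solve-∀)
  open import Relation.Binary.PropositionalEquality
  open import Relation.Nullary using (yes; no; ¬_)

  ≤-by-slack : ∀ {a b} s → a + s ≡ b → a ≤ b
  ≤-by-slack {a} s a+s≡b = subst (a ≤_) a+s≡b (m≤m+n a s)

  ratio-≤ : ∀ {a b x y} → a * x ≡ b * y → a ≤ b → 0 < b → y ≤ x
  ratio-≤ {a} {b} {x} {y} ax≡by a≤b 0<b =
    *-cancelˡ-≤ b {{>-nonZero 0<b}} (subst (_≤ b * x) ax≡by (*-monoˡ-≤ x a≤b))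

  compose-ratios : ∀ {x y z} D₁ N₁ D₂ N₂ → D₁ * y ≡ N₁ * x → D₂ * z ≡ N₂ * y → D₂ * D₁ * z ≡ N₂ * N₁ * x
  compose-ratios {x} {y} {z} D₁ N₁ D₂ N₂ s₁ s₂ = begin
    D₂ * D₁ * z   ≡⟨ swap D₂ D₁ z ⟩
    D₁ * (D₂ * z) ≡⟨ cong (D₁ *_) s₂ ⟩
    D₁ * (N₂ * y) ≡⟨ swap′ D₁ N₂ y ⟩
    N₂ * (D₁ * y) ≡⟨ cong (N₂ *_) s₁ ⟩
    N₂ * (N₁ * x) ≡⟨ *-assoc N₂ N₁ x ⟨
    N₂ * N₁ * x   ∎
    where
    open ≡-Reasoning
    swap : ∀ a b c → a * b * c ≡ b * (a * c)
    swap = solve-∀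
    swap′ : ∀ a b c → a * (b * c) ≡ b * (a * c)
    swap′ = solve-∀

  rise-propagates : ∀ {x y z} D₁ N₁ D₂ N₂ → D₁ * y ≡ N₁ * x → D₂ * z ≡ N₂ * y → 0 < D₁ →
                    N₁ + D₂ ≤ N₂ + D₁ → x < y → y < z
  rise-propagates {x} {y} {z} D₁ N₁ D₂ N₂ s₁ s₂ 0<D₁ excess x<y = ≰⇒> z≰y
    where
    D₁<N₁ : D₁ < N₁
    D₁<N₁ = ≰⇒> (λ N₁≤D₁ → <⇒≱ x<y (ratio-≤ (sym s₁) N₁≤D₁ 0<D₁))
    D₂<N₂ : D₂ < N₂
    D₂<N₂ = +-cancelˡ-< D₁ D₂ N₂ (<-≤-trans (+-monoˡ-< D₂ D₁<N₁)
                                            (subst (N₁ + D₂ ≤_) (+-comm N₂ D₁) excess))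
    z≰y : ¬ z ≤ y
    z≰y z≤y = <-irrefl refl (begin-strict
      N₂ * y ≡⟨ s₂ ⟨
      D₂ * z ≤⟨ *-monoʳ-≤ D₂ z≤y ⟩
      D₂ * y <⟨ *-monoˡ-< y {{>-nonZero (≤-<-trans z≤n x<y)}} D₂<N₂ ⟩
      N₂ * y ∎)
      where open ≤-Reasoning

  module _ {f : ℕ → ℕ} {T : ℕ}
           (no-peak : ∀ t → suc (suc t) ≤ T → f t < f (suc t) → f (suc t) < f (suc (suc t))) where

    rising-to-end : ∀ t n → suc t + n ≡ T → f t < f (suc t) → f (suc t) ≤ f T
    rising-to-end t zero    1+t≡T rise = ≤-reflexive (cong f (trans (sym (+-identityʳ (suc t))) 1+t≡T))
    rising-to-end t (suc n) e     rise = ≤-trans (<⇒≤ rise′) (rising-to-end (suc t) n e′ rise′)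
      where
      e′ : suc (suc t) + n ≡ T
      e′ = trans (sym (+-suc (suc t) n)) e
      rise′ : f (suc t) < f (suc (suc t))
      rise′ = no-peak t (≤-by-slack n e′) rise

    bounded-by-ends : ∀ t → t ≤ T → f t ≤ f 0 ⊔ f T
    bounded-by-ends zero    _   = m≤m⊔n (f 0) (f T)
    bounded-by-ends (suc t) t<T with f t <? f (suc t)
    ... | yes rise = m≤n⇒m≤o⊔n (f 0) (rising-to-end t (T ∸ suc t) (m+[n∸m]≡n t<T) rise)
    ... | no ¬rise = ≤-trans (≮⇒≥ ¬rise) (bounded-by-ends t (<⇒≤ t<T))

  module _ {g : ℕ → ℕ} {T : ℕ} (D N : ℕ → ℕ → ℕ)
           (step : ∀ t r → suc t + r ≡ T → D t r * g (suc t) ≡ N t r * g t)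
           (D-pos : ∀ t r → 0 < D t r)
           (excess-mono : ∀ t r → N t (suc r) + D (suc t) r ≤ N (suc t) r + D t (suc r)) where

    ratio-valley : ∀ t → t ≤ T → g t ≤ g 0 ⊔ g T
    ratio-valley = bounded-by-ends no-peak
      where
      no-peak : ∀ t → suc (suc t) ≤ T → g t < g (suc t) → g (suc t) < g (suc (suc t))
      no-peak t 2+t≤T = rise-propagates (D t (suc r)) (N t (suc r)) (D (suc t) r) (N (suc t) r)
                        (step t (suc r) e₁) (step (suc t) r e₂) (D-pos t (suc r)) (excess-mono t r)
        where
        r = T ∸ suc (suc t)
        e₂ : suc (suc t) + r ≡ T
        e₂ = m+[n∸m]≡n 2+t≤T
        e₁ : suc t + suc r ≡ T
        e₁ = trans (+-suc (suc t) r) e₂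

module Magnitudes where

  open import Data.Nat as ℕ using (ℕ; zero; suc; _≤_; _<_; z≤n; s≤s; _⊔_)
  import Data.Nat.Properties as ℕ
  open import Data.Integer as ℤ using (ℤ; +_; -[1+_]; -_; _*_; 0ℤ; 1ℤ; ∣_∣; +≤+; -≤+)
  import Data.Integer.Properties as ℤ
  open import Data.Integer.Tactic.RingSolver using (solve-∀)
  open import Relation.Binary.PropositionalEquality
  open import Defs using (sign; sumTo)
  open Binomials
  open IntegerBinomials using (B)
  open ThreeTermRecurrence using (Eig; Eig-sum; sumTo-first; sumTo-last)
  open Factorization using (aff; affℕ; aff≡pos)
  open Valley
  import Data.Nat.Tactic.RingSolver as ℕ-Solver
  open import Data.Product using (_,_)
  open import Data.Sum using (inj₁; inj₂)

  ∣sign*∣ : ∀ h x → ∣ sign h * x ∣ ≡ ∣ x ∣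
  ∣sign*∣ zero    x = cong ∣_∣ (ℤ.*-identityˡ x)
  ∣sign*∣ (suc h) x = trans (cong ∣_∣ (sym (ℤ.neg-distribˡ-* (sign h) x)))
                            (trans (ℤ.∣-i∣≡∣i∣ (sign h * x)) (∣sign*∣ h x))

  Eig-at-0 : ∀ d j → Eig d j 0 ≡ + (binom d j ℕ.* binom (suc d) j)
  Eig-at-0 d j = begin
    Eig d j 0                                  ≡⟨ Eig-sum d j 0 z≤n ⟩
    sumTo j _                                  ≡⟨ sumTo-first j _ (λ h → ℤ.*-zeroʳ (sign (suc h))) ⟩
    + 1 * (+ 1 * B d j * B (suc d) j)          ≡⟨ ℤ.*-identityˡ _ ⟩
    + 1 * B d j * B (suc d) j                  ≡⟨ cong (_* B (suc d) j) (ℤ.*-identityˡ (B d j)) ⟩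
    B d j * B (suc d) j                        ≡⟨ ℤ.pos-* (binom d j) (binom (suc d) j) ⟨
    + (binom d j ℕ.* binom (suc d) j)          ∎
    where open ≡-Reasoning

  ∣Eig-at-top∣ : ∀ d j → ∣ Eig d j d ∣ ≡ binom d j
  ∣Eig-at-top∣ d j = begin
    ∣ Eig d j d ∣
      ≡⟨ cong ∣_∣ (Eig-sum d j d ℕ.≤-refl) ⟩
    ∣ sumTo j (λ h → sign h * (B d h * B (d ℕ.∸ d) (j ℕ.∸ h) * B (suc (d ℕ.∸ d)) (j ℕ.∸ h))) ∣
      ≡⟨ cong (λ a → ∣ sumTo j (λ h → sign h * (B d h * B a (j ℕ.∸ h) * B (suc a) (j ℕ.∸ h))) ∣) (ℕ.n∸n≡0 d) ⟩
    ∣ sumTo j (λ h → sign h * (B d h * B 0 (j ℕ.∸ h) * B 1 (j ℕ.∸ h))) ∣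
      ≡⟨ cong ∣_∣ (sumTo-last j _ vanish) ⟩
    ∣ sign j * (B d j * B 0 (j ℕ.∸ j) * B 1 (j ℕ.∸ j)) ∣
      ≡⟨ ∣sign*∣ j _ ⟩
    ∣ B d j * B 0 (j ℕ.∸ j) * B 1 (j ℕ.∸ j) ∣
      ≡⟨ cong (λ t → ∣ B d j * B 0 t * B 1 t ∣) (ℕ.n∸n≡0 j) ⟩
    ∣ B d j * 1ℤ * 1ℤ ∣
      ≡⟨ cong ∣_∣ (trans (ℤ.*-identityʳ (B d j * 1ℤ)) (ℤ.*-identityʳ (B d j))) ⟩
    binom d j ∎
    where
    open ≡-Reasoning
    vanish : ∀ h → h < j → sign h * (B d h * B 0 (j ℕ.∸ h) * B 1 (j ℕ.∸ h)) ≡ 0ℤ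
    vanish h h<j = trans (cong (λ t → sign h * (B d h * B 0 t * B 1 t)) (ℕ.+-∸-assoc 1 h<j))
                         (annihilate (sign h) (B d h) (B 1 (suc (j ℕ.∸ suc h))))
      where
      annihilate : ∀ s x y → s * (x * 0ℤ * y) ≡ 0ℤ
      annihilate = solve-∀

  nonpos≡-abs : ∀ {x} → x ℤ.≤ 0ℤ → x ≡ - + ∣ x ∣
  nonpos≡-abs {+ zero}   _ = refl
  nonpos≡-abs { -[1+ n ]} _ = refl
  nonpos≡-abs {+ suc n}  (+≤+ ())

  -abs≤ : ∀ x → - + ∣ x ∣ ℤ.≤ x
  -abs≤ (+ n)    = ℤ.neg-≤-pos
  -abs≤ -[1+ n ] = ℤ.≤-refl

  minimum-from-magnitudes : ∀ (e : ℕ → ℤ) {d} → e 2 ℤ.≤ 0ℤ → 0ℤ ℤ.≤ e 0 →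
    (∀ i → 1 ≤ i → i ≤ d → ∣ e i ∣ ≤ ∣ e 2 ∣) → ∀ i → i ≤ d → e 2 ℤ.≤ e i
  minimum-from-magnitudes e e₂≤0 0≤e₀ bound zero    _   = ℤ.≤-trans e₂≤0 0≤e₀
  minimum-from-magnitudes e e₂≤0 0≤e₀ bound (suc i) i≤d = begin
    e 2                 ≡⟨ nonpos≡-abs e₂≤0 ⟩
    - + ∣ e 2 ∣         ≤⟨ ℤ.neg-mono-≤ (+≤+ (bound (suc i) (s≤s z≤n) i≤d)) ⟩
    - + ∣ e (suc i) ∣   ≤⟨ -abs≤ (e (suc i)) ⟩
    e (suc i)           ∎
    where open ℤ.≤-Reasoning

  nonneg-if-product : ∀ P x {n} → 0 < P → + P * x ≡ + n → 0ℤ ℤ.≤ x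
  nonneg-if-product (suc p) (+ m)    _ _  = +≤+ z≤n
  nonneg-if-product (suc p) -[1+ m ] _ ()

  nonpos-if-product : ∀ P x n → 0 < P → + P * x ≡ - + n → x ℤ.≤ 0ℤ
  nonpos-if-product (suc p) (+ zero)  n       _ _  = +≤+ z≤n
  nonpos-if-product (suc p) -[1+ m ]  n       _ _  = -≤+
  nonpos-if-product (suc p) (+ suc m) zero    _ ()
  nonpos-if-product (suc p) (+ suc m) (suc n) _ ()

  magnitude : ∀ P Q x y {p q} → P * x ≡ Q * y → ∣ P ∣ ≡ p → ∣ Q ∣ ≡ q → p ℕ.* ∣ x ∣ ≡ q ℕ.* ∣ y ∣
  magnitude P Q x y Px≡Qy refl refl = trans (sym (ℤ.abs-* P x)) (trans (cong ∣_∣ Px≡Qy) (ℤ.abs-* Q y))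

  ∣aff∣ : ∀ c a b m r → ∣ aff c a b (+ m) (+ r) ∣ ≡ affℕ c a b m r
  ∣aff∣ c a b m r = cong ∣_∣ (aff≡pos c a b m r)

  ∣-aff∣ : ∀ c a b m r → ∣ - aff c a b (+ m) (+ r) ∣ ≡ affℕ c a b m r
  ∣-aff∣ c a b m r = trans (ℤ.∣-i∣≡∣i∣ (aff c a b (+ m) (+ r))) (∣aff∣ c a b m r)

  bound-by-multiple : ∀ {x c} bd a b → 0 < a → a ℕ.* x ≡ b ℕ.* (bd ℕ.* c) → a ≤ b ℕ.* c → bd ≤ x
  bound-by-multiple {x} {c} bd a b 0<a ax≡ a≤bc = ℕ.*-cancelˡ-≤ a {{ℕ.>-nonZero 0<a}} (begin
    a ℕ.* bd           ≤⟨ ℕ.*-monoˡ-≤ bd a≤bc ⟩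
    b ℕ.* c ℕ.* bd     ≡⟨ regroup b c bd ⟩
    b ℕ.* (bd ℕ.* c)   ≡⟨ ax≡ ⟨
    a ℕ.* x            ∎)
    where
    open ℕ.≤-Reasoning
    regroup : ∀ b c bd → b ℕ.* c ℕ.* bd ≡ b ℕ.* (bd ℕ.* c)
    regroup = ℕ-Solver.solve-∀

  module EvenDegreeMinimum (R₀ : ℕ) where

    open Factorization.EvenDegree (suc R₀) using (e; even-step; odd-step)

    f : ℕ → ℕ
    f i = ∣ e i ∣

    even-stepℕ : ∀ m r → suc R₀ ≡ suc (m ℕ.+ r) →
      affℕ 5 2 4 m r ℕ.* f (suc (double m)) ≡ affℕ 0 2 0 m r ℕ.* f (double m)
    even-stepℕ m r k≡ = magnitude (aff 5 2 4 (+ m) (+ r)) (aff 0 2 0 (+ m) (+ r)) (e (suc (double m))) (e (double m))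
                                  (even-step m r k≡) (∣aff∣ 5 2 4 m r) (∣aff∣ 0 2 0 m r)

    odd-stepℕ : ∀ m r → suc R₀ ≡ suc (m ℕ.+ r) →
      affℕ 0 0 2 m r ℕ.* f (suc (suc (double m))) ≡ affℕ 1 0 2 m r ℕ.* f (suc (double m))
    odd-stepℕ m r k≡ = magnitude (aff 0 0 2 (+ m) (+ r)) (- aff 1 0 2 (+ m) (+ r)) (e (suc (suc (double m))))
                                 (e (suc (double m))) (odd-step m r k≡) (∣aff∣ 0 0 2 m r) (∣-aff∣ 1 0 2 m r)

    D N : ℕ → ℕ → ℕ
    D t r = affℕ 0 0 2 (suc t) r ℕ.* affℕ 5 2 4 (suc t) r
    N t r = affℕ 1 0 2 (suc t) r ℕ.* affℕ 0 2 0 (suc t) r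
    {-# INLINE D #-}
    {-# INLINE N #-}

    g : ℕ → ℕ
    g t = f (double (suc t))

    g-step : ∀ t r → suc t ℕ.+ r ≡ R₀ → D t r ℕ.* g (suc t) ≡ N t r ℕ.* g t
    g-step t r t+r≡ = compose-ratios {x = g t} {f (suc (double (suc t)))} {g (suc t)} (affℕ 5 2 4 (suc t) r) (affℕ 0 2 0 (suc t) r) (affℕ 0 0 2 (suc t) r)
                                    (affℕ 1 0 2 (suc t) r) (even-stepℕ (suc t) r k≡) (odd-stepℕ (suc t) r k≡)
      where k≡ = cong suc (sym t+r≡)

    g-valley : ∀ t → t ≤ R₀ → g t ≤ g 0 ⊔ g R₀
    g-valley = ratio-valley {g = g} D N g-step (λ _ _ → s≤s z≤n)
                            (λ t r → ≤-by-slack (24 ℕ.+ 16 ℕ.* r) (polynomial t r))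
      where
      polynomial : ∀ t r → N t (suc r) ℕ.+ D (suc t) r ℕ.+ (24 ℕ.+ 16 ℕ.* r) ≡ N (suc t) r ℕ.+ D t (suc r)
      polynomial = ℕ-Solver.solve-∀

    top≤second : g R₀ ≤ f 2
    top≤second = subst (_≤ f 2) (sym (∣Eig-at-top∣ (double (suc R₀)) (suc R₀)))
      (bound-by-multiple (binom (double (suc R₀)) (suc R₀)) (A ℕ.* P) (Q₁ ℕ.* Q₀) (s≤s z≤n)
        (trans (compose-ratios {x = f 0} {f 1} {f 2} P Q₀ A Q₁ (even-stepℕ 0 R₀ refl) (odd-stepℕ 0 R₀ refl))
               (cong (Q₁ ℕ.* Q₀ ℕ.*_) (cong ∣_∣ (Eig-at-0 (double (suc R₀)) (suc R₀)))))
        (begin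
          A ℕ.* P                                               ≡⟨ polynomial₁ R₀ ⟩
          (1 ℕ.+ 2 ℕ.* R₀) ℕ.* (6 ℕ.+ 4 ℕ.* R₀)                 ≤⟨ central-bound-even R₀ ⟩
          (2 ℕ.+ 2 ℕ.* R₀) ℕ.* binom (3 ℕ.+ double R₀) (suc R₀) ≡⟨ polynomial₂ R₀ (binom (3 ℕ.+ double R₀) (suc R₀)) ⟩
          Q₁ ℕ.* Q₀ ℕ.* binom (3 ℕ.+ double R₀) (suc R₀)        ∎))
      where
      open ℕ.≤-Reasoning
      P = affℕ 5 2 4 0 R₀
      Q₀ = affℕ 0 2 0 0 R₀
      A = affℕ 0 0 2 0 R₀
      Q₁ = affℕ 1 0 2 0 R₀
      polynomial₁ : ∀ r → affℕ 0 0 2 0 r ℕ.* affℕ 5 2 4 0 r ≡ (1 ℕ.+ 2 ℕ.* r) ℕ.* (6 ℕ.+ 4 ℕ.* r)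
      polynomial₁ = ℕ-Solver.solve-∀
      polynomial₂ : ∀ r x → (2 ℕ.+ 2 ℕ.* r) ℕ.* x ≡ affℕ 1 0 2 0 r ℕ.* affℕ 0 2 0 0 r ℕ.* x
      polynomial₂ = ℕ-Solver.solve-∀

    even-index-bound : ∀ t → t ≤ R₀ → g t ≤ f 2
    even-index-bound t t≤R₀ = ℕ.≤-trans (g-valley t t≤R₀) (ℕ.⊔-lub ℕ.≤-refl top≤second)

    odd-index-bound : ∀ m r → suc R₀ ≡ suc (m ℕ.+ r) → f (suc (double m)) ≤ g m
    odd-index-bound m r k≡ = ratio-≤ (odd-stepℕ m r k≡) (≤-by-slack 1 (polynomial m r)) (s≤s z≤n)
      where
      polynomial : ∀ m r → affℕ 0 0 2 m r ℕ.+ 1 ≡ affℕ 1 0 2 m r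
      polynomial = ℕ-Solver.solve-∀

    e₀≥0 : 0ℤ ℤ.≤ e 0
    e₀≥0 = subst (0ℤ ℤ.≤_) (sym (Eig-at-0 (double (suc R₀)) (suc R₀))) (+≤+ z≤n)

    e₁≥0 : 0ℤ ℤ.≤ e 1
    e₁≥0 = nonneg-if-product (affℕ 5 2 4 0 R₀) (e 1) (s≤s z≤n) (begin
      + affℕ 5 2 4 0 R₀ * e 1                 ≡⟨ cong (_* e 1) (aff≡pos 5 2 4 0 R₀) ⟨
      aff 5 2 4 (+ 0) (+ R₀) * e 1            ≡⟨ even-step 0 R₀ refl ⟩
      aff 0 2 0 (+ 0) (+ R₀) * e 0            ≡⟨ cong₂ _*_ (aff≡pos 0 2 0 0 R₀) (Eig-at-0 (double (suc R₀)) (suc R₀)) ⟩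
      + affℕ 0 2 0 0 R₀ * + (binom (double (suc R₀)) (suc R₀) ℕ.* binom (suc (double (suc R₀))) (suc R₀))
                                              ≡⟨ ℤ.pos-* (affℕ 0 2 0 0 R₀) _ ⟨
      + _                                     ∎)
      where open ≡-Reasoning

    e₂≤0 : e 2 ℤ.≤ 0ℤ
    e₂≤0 = nonpos-if-product (affℕ 0 0 2 0 R₀) (e 2) (affℕ 1 0 2 0 R₀ ℕ.* f 1) (s≤s z≤n) (begin
      + affℕ 0 0 2 0 R₀ * e 2                 ≡⟨ cong (_* e 2) (aff≡pos 0 0 2 0 R₀) ⟨
      aff 0 0 2 (+ 0) (+ R₀) * e 2            ≡⟨ odd-step 0 R₀ refl ⟩
      - aff 1 0 2 (+ 0) (+ R₀) * e 1          ≡⟨ cong₂ (λ q x → - q * x) (sym (aff≡pos 1 0 2 0 R₀)) (ℤ.0≤i⇒+∣i∣≡i e₁≥0) ⟨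
      - + affℕ 1 0 2 0 R₀ * + f 1             ≡⟨ ℤ.neg-distribˡ-* (+ affℕ 1 0 2 0 R₀) (+ f 1) ⟨
      - (+ affℕ 1 0 2 0 R₀ * + f 1)           ≡⟨ cong -_ (ℤ.pos-* (affℕ 1 0 2 0 R₀) (f 1)) ⟨
      - + (affℕ 1 0 2 0 R₀ ℕ.* f 1)           ∎)
      where open ≡-Reasoning

    magnitude-bound : ∀ i → 1 ≤ i → i ≤ double (suc R₀) → f i ≤ f 2
    magnitude-bound i 1≤i i≤d with even-or-odd i
    magnitude-bound _ ()  _   | inj₁ (zero , refl)
    ... | inj₁ (suc t , refl) = even-index-bound t (ℕ.≤-pred (double-≤-cancel (ℕ.m≤n⇒m≤1+n i≤d)))
    ... | inj₂ (m , refl)     = ℕ.≤-trans (odd-index-bound m (R₀ ℕ.∸ m) (cong suc (sym (ℕ.m+[n∸m]≡n m≤R₀))))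
                                          (even-index-bound m m≤R₀)
      where
      m≤R₀ : m ≤ R₀
      m≤R₀ = double-≤-cancel (ℕ.≤-pred i≤d)

    minimum : ∀ i → i ≤ double (suc R₀) → e 2 ℤ.≤ e i
    minimum = minimum-from-magnitudes e e₂≤0 e₀≥0 magnitude-bound

  aff²≡pos : ∀ c a b c′ a′ b′ m r →
    aff c a b (+ m) (+ r) * aff c′ a′ b′ (+ m) (+ r) ≡ + (affℕ c a b m r ℕ.* affℕ c′ a′ b′ m r)
  aff²≡pos c a b c′ a′ b′ m r =
    trans (cong₂ _*_ (aff≡pos c a b m r) (aff≡pos c′ a′ b′ m r)) (sym (ℤ.pos-* (affℕ c a b m r) _))

  module OddDegreeMinimum (R₀ : ℕ) where

    open Factorization.OddDegree (suc R₀) using (e; even-step; odd-step)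

    f : ℕ → ℕ
    f i = ∣ e i ∣

    even-stepℕ : ∀ m r → suc R₀ ≡ m ℕ.+ r →
      affℕ 3 2 4 m r ℕ.* affℕ 0 0 2 m r ℕ.* f (suc (double m)) ≡ affℕ 0 2 0 m r ℕ.* affℕ 1 0 2 m r ℕ.* f (double m)
    even-stepℕ m r k≡ = magnitude (aff 3 2 4 (+ m) (+ r) * aff 0 0 2 (+ m) (+ r))
                                  (- (aff 0 2 0 (+ m) (+ r) * aff 1 0 2 (+ m) (+ r)))
                                  (e (suc (double m))) (e (double m)) (even-step m r k≡)
                                  (cong ∣_∣ (aff²≡pos 3 2 4 0 0 2 m r))
                                  (trans (ℤ.∣-i∣≡∣i∣ (aff 0 2 0 (+ m) (+ r) * aff 1 0 2 (+ m) (+ r)))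
                                         (cong ∣_∣ (aff²≡pos 0 2 0 1 0 2 m r)))

    odd-stepℕ : ∀ m r → suc R₀ ≡ suc (m ℕ.+ r) → f (suc (suc (double m))) ≡ f (suc (double m))
    odd-stepℕ m r k≡ = cong ∣_∣ (odd-step m r k≡)

    D N : ℕ → ℕ → ℕ
    D t r = affℕ 3 2 4 (suc t) (suc r) ℕ.* affℕ 0 0 2 (suc t) (suc r)
    N t r = affℕ 0 2 0 (suc t) (suc r) ℕ.* affℕ 1 0 2 (suc t) (suc r)
    {-# INLINE D #-}
    {-# INLINE N #-}

    g : ℕ → ℕ
    g t = f (double (suc t))

    g-step : ∀ t r → suc t ℕ.+ r ≡ R₀ → D t r ℕ.* g (suc t) ≡ N t r ℕ.* g t
    g-step t r t+r≡ = trans (cong (D t r ℕ.*_) (odd-stepℕ (suc t) r (cong suc (sym t+r≡))))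
                            (even-stepℕ (suc t) (suc r) (trans (cong suc (sym t+r≡)) (sym (ℕ.+-suc (suc t) r))))

    g-valley : ∀ t → t ≤ R₀ → g t ≤ g 0 ⊔ g R₀
    g-valley = ratio-valley {g = g} D N g-step (λ _ _ → s≤s z≤n)
                            (λ t r → ≤-by-slack (36 ℕ.+ 16 ℕ.* r) (polynomial t r))
      where
      polynomial : ∀ t r → N t (suc r) ℕ.+ D (suc t) r ℕ.+ (36 ℕ.+ 16 ℕ.* r) ≡ N (suc t) r ℕ.+ D t (suc r)
      polynomial = ℕ-Solver.solve-∀

    top≤second : f (suc (double (suc R₀))) ≤ f 2
    top≤second = subst (_≤ f 2) (sym (∣Eig-at-top∣ (suc (double (suc R₀))) (suc (suc R₀))))
      (bound-by-multiple (binom (suc (double (suc R₀))) (suc (suc R₀))) P Q (s≤s z≤n)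
        (trans (cong (P ℕ.*_) (odd-stepℕ 0 R₀ refl))
               (trans (even-stepℕ 0 (suc R₀) refl)
                      (cong (Q ℕ.*_) (cong ∣_∣ (Eig-at-0 (suc (double (suc R₀))) (suc (suc R₀)))))))
        (begin
          P                                                          ≡⟨ polynomial₁ R₀ ⟩
          (4 ℕ.+ 2 ℕ.* R₀) ℕ.* (2 ℕ.+ 4 ℕ.* suc R₀)                    ≤⟨ ℕ.*-monoʳ-≤ (4 ℕ.+ 2 ℕ.* R₀) (central-bound-odd (suc R₀)) ⟩
          (4 ℕ.+ 2 ℕ.* R₀) ℕ.* binom (2 ℕ.+ double (suc R₀)) (suc (suc R₀)) ≡⟨ polynomial₂ R₀ (binom (2 ℕ.+ double (suc R₀)) (suc (suc R₀))) ⟩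
          Q ℕ.* binom (2 ℕ.+ double (suc R₀)) (suc (suc R₀))          ∎))
      where
      open ℕ.≤-Reasoning
      P = affℕ 3 2 4 0 (suc R₀) ℕ.* affℕ 0 0 2 0 (suc R₀)
      Q = affℕ 0 2 0 0 (suc R₀) ℕ.* affℕ 1 0 2 0 (suc R₀)
      polynomial₁ : ∀ r → affℕ 3 2 4 0 (suc r) ℕ.* affℕ 0 0 2 0 (suc r) ≡ (4 ℕ.+ 2 ℕ.* r) ℕ.* (2 ℕ.+ 4 ℕ.* suc r)
      polynomial₁ = ℕ-Solver.solve-∀
      polynomial₂ : ∀ r x → (4 ℕ.+ 2 ℕ.* r) ℕ.* x ≡ affℕ 0 2 0 0 (suc r) ℕ.* affℕ 1 0 2 0 (suc r) ℕ.* x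
      polynomial₂ = ℕ-Solver.solve-∀

    last-even≤top : g R₀ ≤ f (suc (double (suc R₀)))
    last-even≤top = ratio-≤ {a = affℕ 3 2 4 (suc R₀) 0 ℕ.* affℕ 0 0 2 (suc R₀) 0}
                            {b = affℕ 0 2 0 (suc R₀) 0 ℕ.* affℕ 1 0 2 (suc R₀) 0}
                            (even-stepℕ (suc R₀) 0 (sym (ℕ.+-identityʳ (suc R₀))))
                            (≤-by-slack (2 ℕ.* R₀) (polynomial R₀)) (s≤s z≤n)
      where
      polynomial : ∀ r → affℕ 3 2 4 (suc r) 0 ℕ.* affℕ 0 0 2 (suc r) 0 ℕ.+ 2 ℕ.* r
                         ≡ affℕ 0 2 0 (suc r) 0 ℕ.* affℕ 1 0 2 (suc r) 0
      polynomial = ℕ-Solver.solve-∀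

    even-index-bound : ∀ t → t ≤ R₀ → g t ≤ f 2
    even-index-bound t t≤R₀ =
      ℕ.≤-trans (g-valley t t≤R₀) (ℕ.⊔-lub ℕ.≤-refl (ℕ.≤-trans last-even≤top top≤second))

    e₀≥0 : 0ℤ ℤ.≤ e 0
    e₀≥0 = subst (0ℤ ℤ.≤_) (sym (Eig-at-0 (suc (double (suc R₀))) (suc (suc R₀)))) (+≤+ z≤n)

    e₂≤0 : e 2 ℤ.≤ 0ℤ
    e₂≤0 = subst (ℤ._≤ 0ℤ) (sym (odd-step 0 R₀ refl)) (nonpos-if-product P (e 1) (Q ℕ.* f 0) (s≤s z≤n) (begin
      + P * e 1                                                    ≡⟨ cong (_* e 1) (aff²≡pos 3 2 4 0 0 2 0 (suc R₀)) ⟨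
      aff 3 2 4 (+ 0) (+ suc R₀) * aff 0 0 2 (+ 0) (+ suc R₀) * e 1 ≡⟨ even-step 0 (suc R₀) refl ⟩
      - (aff 0 2 0 (+ 0) (+ suc R₀) * aff 1 0 2 (+ 0) (+ suc R₀)) * e 0
        ≡⟨ cong₂ (λ q x → - q * x) (aff²≡pos 0 2 0 1 0 2 0 (suc R₀)) (sym (ℤ.0≤i⇒+∣i∣≡i e₀≥0)) ⟩
      - + Q * + f 0                                                ≡⟨ ℤ.neg-distribˡ-* (+ Q) (+ f 0) ⟨
      - (+ Q * + f 0)                                              ≡⟨ cong -_ (ℤ.pos-* Q (f 0)) ⟨
      - + (Q ℕ.* f 0)                                              ∎))
      where
      open ≡-Reasoning
      P = affℕ 3 2 4 0 (suc R₀) ℕ.* affℕ 0 0 2 0 (suc R₀)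
      Q = affℕ 0 2 0 0 (suc R₀) ℕ.* affℕ 1 0 2 0 (suc R₀)

    magnitude-bound : ∀ i → 1 ≤ i → i ≤ suc (double (suc R₀)) → f i ≤ f 2
    magnitude-bound i 1≤i i≤d with even-or-odd i
    magnitude-bound _ ()  _   | inj₁ (zero , refl)
    ... | inj₁ (suc t , refl) = even-index-bound t (ℕ.≤-pred (double-≤-cancel i≤d))
    ... | inj₂ (m , refl) with ℕ.m≤n⇒m<n∨m≡n (double-≤-cancel (ℕ.m≤n⇒m≤1+n (ℕ.≤-pred i≤d)))
    ...   | inj₂ refl   = top≤second
    ...   | inj₁ m<k    = subst (_≤ f 2) (odd-stepℕ m (R₀ ℕ.∸ m) (cong suc (sym (ℕ.m+[n∸m]≡n (ℕ.≤-pred m<k)))))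
                                  (even-index-bound m (ℕ.≤-pred m<k))

    minimum : ∀ i → i ≤ suc (double (suc R₀)) → e 2 ℤ.≤ e i
    minimum = minimum-from-magnitudes e e₂≤0 e₀≥0 magnitude-bound

open import Defs
open import Data.Nat using (ℕ; zero; suc; _≤_; _+_; _*_; s≤s; z≤n)
open import Data.Nat.DivMod using (_/_; m/n≡1+[m∸n]/n)
open import Data.Integer as ℤ using (ℤ)
open import Data.Product using (_,_)
open import Data.Sum using (inj₁; inj₂)
open import Relation.Binary.PropositionalEquality using (_≡_; refl; sym; trans; cong; subst)
open Binomials using (double; even-or-odd)
open ThreeTermRecurrence using (Eig)
open Magnitudes

2+n/2 : ∀ n → (2 + n) / 2 ≡ suc (n / 2)
2+n/2 n = m/n≡1+[m∸n]/n {2 + n} {2} (s≤s (s≤s z≤n))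

⌈double/2⌉ : ∀ k → ⌈ double k /2⌉ ≡ k
⌈double/2⌉ zero    = refl
⌈double/2⌉ (suc k) = trans (2+n/2 (double k + 1)) (cong suc (⌈double/2⌉ k))

⌈double+1/2⌉ : ∀ k → ⌈ suc (double k) /2⌉ ≡ suc k
⌈double+1/2⌉ zero    = refl
⌈double+1/2⌉ (suc k) = trans (2+n/2 (suc (double k) + 1)) (cong suc (⌈double+1/2⌉ k))

lemma6p2 : (d : ℕ) → 2 ≤ d → (i : ℕ) → i ≤ d →
    E (2 * d + 1) d ⌈ d /2⌉ 2 ℤ.≤ E (2 * d + 1) d ⌈ d /2⌉ i
lemma6p2 d 2≤d i i≤d with even-or-odd d
lemma6p2 _ ()       _ _ | inj₁ (zero , refl)
lemma6p2 _ (s≤s ()) _ _ | inj₂ (zero , refl)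
... | inj₁ (suc r , refl) =
  subst (λ j → Eig (double (suc r)) j 2 ℤ.≤ Eig (double (suc r)) j i) (sym (⌈double/2⌉ (suc r)))
        (EvenDegreeMinimum.minimum r i i≤d)
... | inj₂ (suc r , refl) =
  subst (λ j → Eig (suc (double (suc r))) j 2 ℤ.≤ Eig (suc (double (suc r))) j i) (sym (⌈double+1/2⌉ (suc r)))
        (OddDegreeMinimum.minimum r i i≤d)
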